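{- The translation $J$ from the language of $\mathrm{STT}^\uparrow$ to the language of $\mathrm{CTT}^\omega$, which preserves all logical vocabulary, sends $y^{n+1}(x^n)$ to $y^{n+1}(x^n)$, and sends each term $\uparrow x^n$ to the definite description $\iota x^{n+1}(x^n\equiv x^{n+1})$, is an interpretation: every theorem of $\mathrm{STT}^\uparrow$ is translated into a theorem of $\mathrm{CTT}^\omega$ (definite descriptions being eliminated in the standard Russellian way).
   Context: $\mathrm{CTT}^\omega$: cumulative type theory with types $n<\omega$; atomic formulas $y^n(x^m)$ well-formed iff $m<n$, and $a^n=b^n$ (same type); classical natural deduction with usual identity rules at each type; quantifier rules: for $m\le n$, from $\forall x^n\phi(x^n)$ infer $\phi(a^m)$, and from $\phi(b^n)$ infer $\forall x^m\phi(x^m)$ (all expressions well-formed, $b^n$ not in undischarged assumptions); dually for $\exists$. Comprehension: $\exists z^{n+1}\forall x^n(z^{n+1}(x^n)\leftrightarrow\phi(x^n))$ for well-formed $\phi$ not containing $z^{n+1}$. Defined ($k=\max(m,n)+1$): $a^m\equiv b^n:\Leftrightarrow\forall x^k(x^k(a^m)\leftrightarrow x^k(b^n))$, $a^m\,\hat\in\,b^n:\Leftrightarrow\exists x^k(x^k\equiv b^n\wedge x^k(a^m))$. Axioms: Type-Founded $\forall a^m\forall b^{n+1}(a^m\,\hat\in\,b^{n+1}\to\exists x^n\,a^m\equiv x^n)$; Type-Base $\forall x^0\forall y^m\neg(y^m\,\hat\in\,x^0)$. (In $\mathrm{CTT}^\omega$ each $x^n$ has a unique $x^{n+1}$ with $x^n\equiv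 x^{n+1}$, so the description is proper.) $\mathrm{STT}$: types $n<\omega$; $b^n(a^m)$ well-formed iff $n=m+1$; identity only between same-type terms; quantifier rules only instantiate/generalise at the same type; Comprehension $\exists z^{n+1}\forall x^n(z^{n+1}(x^n)\leftrightarrow\phi(x^n))$ ($\phi$ not containing $z^{n+1}$); identity scheme $x^n=y^n\leftrightarrow\forall z^{n+1}(z^{n+1}(x^n)\leftrightarrow z^{n+1}(y^n))$. $\mathrm{STT}^\uparrow$ adds, for each $n$, a function symbol $\uparrow$ taking type-$n$ terms to type-$(n+1)$ terms, extends Comprehension to formulas containing $\uparrow$, and adds axioms: Up-Inject $\forall x^n\forall y^n(\uparrow x^n=\uparrow y^n\to x^n=y^n)$; Up-Possess $\forall x^n\forall y^{n+1}(\uparrow y^{n+1}(\uparrow x^n)\leftrightarrow y^{n+1}(x^n))$; Up-Founded $\forall x^{n+1}\forall y^{n+1}(\uparrow y^{n+1}(x^{n+1})\to\exists z^n\,x^{n+1}=\uparrow z^n)$; Up-Base $\forall x^0\forall y^0\neg\uparrow y^0(x^0)$. -}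

module Defs where

-- Conventions: variables are de Bruijn indices (ℕ); a context Δ : List ℕ
-- lists the TYPES of the variables in scope (index 0 = innermost).
-- Each binder ∀' n / ∃' n carries the type n of the bound variable.
-- Free variables of a judgement are the variables of Δ, so the
-- eigenvariable conditions of ∀I / ∃E are built in (the eigenvariable is
-- the fresh index 0, which does not occur in the weakened assumptions or
-- the weakened conclusion).

open import Data.Nat using (ℕ; zero; suc; _+_; _⊔_; _≤_; _<_)
open import Data.List using (List; []; _∷_; map)
open import Data.List.Membership.Propositional using (_∈_)
open import Data.Maybe using (Maybe; just; nothing; maybe)
import Data.Maybe as Maybe
open import Data.Product using (_×_; _,_; proj₁; proj₂)

Ctx : Set
Ctx = List ℕ

data _∋_∶_ : Ctx → ℕ → ℕ → Set where
  here  : ∀ {Δ n} → (n ∷ Δ) ∋ 0 ∶ n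
  there : ∀ {Δ i n m} → Δ ∋ i ∶ n → (m ∷ Δ) ∋ suc i ∶ n

wkv : ℕ → ℕ → ℕ
wkv zero    i       = suc i
wkv (suc c) zero    = zero
wkv (suc c) (suc i) = suc (wkv c i)

-- substitution at index c: nothing = "this is the substituted variable",
-- just j = variable becomes j (indices > c are decremented)
hitv : ℕ → ℕ → Maybe ℕ
hitv zero    zero    = nothing
hitv zero    (suc i) = just i
hitv (suc c) zero    = just zero
hitv (suc c) (suc i) = Maybe.map suc (hitv c i)

module CTT where

  infixr 4 _⇒_
  infixr 5 _∨_
  infixr 6 _∧_
  infixr 4 _⇔_

  data Fm : Set where
    ap  : ℕ → ℕ → Fm          -- ap y x  is  y(x)
    eq  : ℕ → ℕ → Fm
    ⊥'  : Fm
    _⇒_ : Fm → Fm → Fm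
    _∧_ : Fm → Fm → Fm
    _∨_ : Fm → Fm → Fm
    ∀'  : ℕ → Fm → Fm         -- ∀' n φ  is  ∀x^n φ   (x = index 0 in φ)
    ∃'  : ℕ → Fm → Fm

  ¬' : Fm → Fm
  ¬' φ = φ ⇒ ⊥'

  _⇔_ : Fm → Fm → Fm
  φ ⇔ ψ = (φ ⇒ ψ) ∧ (ψ ⇒ φ)

  wk : ℕ → Fm → Fm
  wk c (ap y x)  = ap (wkv c y) (wkv c x)
  wk c (eq a b)  = eq (wkv c a) (wkv c b)
  wk c ⊥'        = ⊥'
  wk c (φ ⇒ ψ)   = wk c φ ⇒ wk c ψ
  wk c (φ ∧ ψ)   = wk c φ ∧ wk c ψ
  wk c (φ ∨ ψ)   = wk c φ ∨ wk c ψ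
  wk c (∀' n φ)  = ∀' n (wk (suc c) φ)
  wk c (∃' n φ)  = ∃' n (wk (suc c) φ)

  -- substitute the (outer-context) variable a for index c
  subv : ℕ → ℕ → ℕ → ℕ
  subv c a i = maybe (λ j → j) (c + a) (hitv c i)

  sub : ℕ → ℕ → Fm → Fm
  sub c a (ap y x)  = ap (subv c a y) (subv c a x)
  sub c a (eq x y)  = eq (subv c a x) (subv c a y)
  sub c a ⊥'        = ⊥'
  sub c a (φ ⇒ ψ)   = sub c a φ ⇒ sub c a ψ
  sub c a (φ ∧ ψ)   = sub c a φ ∧ sub c a ψ
  sub c a (φ ∨ ψ)   = sub c a φ ∨ sub c a ψ
  sub c a (∀' n φ)  = ∀' n (sub (suc c) a φ)
  sub c a (∃' n φ)  = ∃' n (sub (suc c) a φ)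

  _[_] : Fm → ℕ → Fm
  φ [ a ] = sub 0 a φ

  data WF (Δ : Ctx) : Fm → Set where
    ap  : ∀ {y x n m} → Δ ∋ y ∶ n → Δ ∋ x ∶ m → m < n → WF Δ (ap y x)
    eq  : ∀ {a b n} → Δ ∋ a ∶ n → Δ ∋ b ∶ n → WF Δ (eq a b)
    ⊥'  : WF Δ ⊥'
    _⇒_ : ∀ {φ ψ} → WF Δ φ → WF Δ ψ → WF Δ (φ ⇒ ψ)
    _∧_ : ∀ {φ ψ} → WF Δ φ → WF Δ ψ → WF Δ (φ ∧ ψ)
    _∨_ : ∀ {φ ψ} → WF Δ φ → WF Δ ψ → WF Δ (φ ∨ ψ)
    ∀'  : ∀ {n φ} → WF (n ∷ Δ) φ → WF Δ (∀' n φ)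
    ∃'  : ∀ {n φ} → WF (n ∷ Δ) φ → WF Δ (∃' n φ)

  -- a^m ≡ b^n  :=  ∀x^k (x(a) ↔ x(b)),  k = max(m,n)+1
  Equiv : ℕ → ℕ → ℕ → ℕ → Fm
  Equiv m n a b = ∀' (suc (m ⊔ n)) (ap 0 (suc a) ⇔ ap 0 (suc b))

  -- a^m ∈̂ b^n  :=  ∃x^k (x ≡ b ∧ x(a)),  k = max(m,n)+1
  Elem : ℕ → ℕ → ℕ → ℕ → Fm
  Elem m n a b = ∃' (suc (m ⊔ n)) (Equiv (suc (m ⊔ n)) n 0 (suc b) ∧ ap 0 (suc a))

  -- ∃z^{n+1} ∀x^n (z(x) ↔ φ(x)),  φ a body with x = index 0
  Comprehension : ℕ → Fm → Fm
  Comprehension n φ = ∃' (suc n) (∀' n (ap 1 0 ⇔ wk 1 φ))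

  -- ∀a^m ∀b^{n+1} (a ∈̂ b → ∃x^n a ≡ x)
  TypeFounded : ℕ → ℕ → Fm
  TypeFounded m n = ∀' m (∀' (suc n) (Elem m (suc n) 1 0 ⇒ ∃' n (Equiv m n 2 0)))

  -- ∀x^0 ∀y^m ¬(y ∈̂ x)
  TypeBase : ℕ → Fm
  TypeBase m = ∀' 0 (∀' m (¬' (Elem m 0 0 1)))

  infix 2 _∣_⊢_

  data _∣_⊢_ : Ctx → List Fm → Fm → Set where
    hyp  : ∀ {Δ Γ φ} → φ ∈ Γ → Δ ∣ Γ ⊢ φ
    ⊥E   : ∀ {Δ Γ φ} → WF Δ φ → Δ ∣ Γ ⊢ ⊥' → Δ ∣ Γ ⊢ φ
    raa  : ∀ {Δ Γ φ} → WF Δ φ → Δ ∣ ¬' φ ∷ Γ ⊢ ⊥' → Δ ∣ Γ ⊢ φ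
    ⇒I   : ∀ {Δ Γ φ ψ} → WF Δ φ → Δ ∣ φ ∷ Γ ⊢ ψ → Δ ∣ Γ ⊢ φ ⇒ ψ
    ⇒E   : ∀ {Δ Γ φ ψ} → Δ ∣ Γ ⊢ φ ⇒ ψ → Δ ∣ Γ ⊢ φ → Δ ∣ Γ ⊢ ψ
    ∧I   : ∀ {Δ Γ φ ψ} → Δ ∣ Γ ⊢ φ → Δ ∣ Γ ⊢ ψ → Δ ∣ Γ ⊢ φ ∧ ψ
    ∧E₁  : ∀ {Δ Γ φ ψ} → Δ ∣ Γ ⊢ φ ∧ ψ → Δ ∣ Γ ⊢ φ
    ∧E₂  : ∀ {Δ Γ φ ψ} → Δ ∣ Γ ⊢ φ ∧ ψ → Δ ∣ Γ ⊢ ψ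
    ∨I₁  : ∀ {Δ Γ φ ψ} → WF Δ ψ → Δ ∣ Γ ⊢ φ → Δ ∣ Γ ⊢ φ ∨ ψ
    ∨I₂  : ∀ {Δ Γ φ ψ} → WF Δ φ → Δ ∣ Γ ⊢ ψ → Δ ∣ Γ ⊢ φ ∨ ψ
    ∨E   : ∀ {Δ Γ φ ψ χ} → Δ ∣ Γ ⊢ φ ∨ ψ → Δ ∣ φ ∷ Γ ⊢ χ → Δ ∣ ψ ∷ Γ ⊢ χ
         → Δ ∣ Γ ⊢ χ
    -- from φ(b^n) infer ∀x^m φ(x^m), m ≤ n, b fresh
    ∀I   : ∀ {Δ Γ φ m n} → m ≤ n → WF (m ∷ Δ) φ
         → (n ∷ Δ) ∣ map (wk 0) Γ ⊢ φ → Δ ∣ Γ ⊢ ∀' m φ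
    ∀E   : ∀ {Δ Γ φ a m n} → m ≤ n → Δ ∋ a ∶ m → WF Δ (φ [ a ])
         → Δ ∣ Γ ⊢ ∀' n φ → Δ ∣ Γ ⊢ φ [ a ]
    ∃I   : ∀ {Δ Γ φ a m n} → m ≤ n → Δ ∋ a ∶ m → WF Δ (∃' n φ)
         → Δ ∣ Γ ⊢ φ [ a ] → Δ ∣ Γ ⊢ ∃' n φ
    -- from ∃x^m φ(x^m) and [φ(b^n)] ⊢ ψ infer ψ, m ≤ n, b fresh
    ∃E   : ∀ {Δ Γ φ ψ m n} → m ≤ n → WF (n ∷ Δ) φ → Δ ∣ Γ ⊢ ∃' m φ
         → (n ∷ Δ) ∣ φ ∷ map (wk 0) Γ ⊢ wk 0 ψ → Δ ∣ Γ ⊢ ψ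
    refl= : ∀ {Δ Γ a n} → Δ ∋ a ∶ n → Δ ∣ Γ ⊢ eq a a
    subst= : ∀ {Δ Γ φ a b n} → WF (n ∷ Δ) φ → Δ ∋ a ∶ n
           → Δ ∣ Γ ⊢ eq a b → Δ ∣ Γ ⊢ φ [ a ] → Δ ∣ Γ ⊢ φ [ b ]
    comp : ∀ {Δ Γ φ n} → WF (n ∷ Δ) φ → Δ ∣ Γ ⊢ Comprehension n φ
    typeFounded : ∀ {Δ Γ} m n → Δ ∣ Γ ⊢ TypeFounded m n
    typeBase    : ∀ {Δ Γ} m → Δ ∣ Γ ⊢ TypeBase m

module STT where

  infixr 4 _⇒_
  infixr 5 _∨_
  infixr 6 _∧_
  infixr 4 _⇔_

  data Tm : Set where
    var : ℕ → Tm
    up  : Tm → Tm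

  data _⊢t_∶_ (Δ : Ctx) : Tm → ℕ → Set where
    var : ∀ {i n} → Δ ∋ i ∶ n → Δ ⊢t var i ∶ n
    up  : ∀ {t n} → Δ ⊢t t ∶ n → Δ ⊢t up t ∶ suc n

  wkT : ℕ → Tm → Tm
  wkT c (var i) = var (wkv c i)
  wkT c (up t)  = up (wkT c t)

  plusT : ℕ → Tm → Tm
  plusT c (var i) = var (c + i)
  plusT c (up t)  = up (plusT c t)

  subT : ℕ → Tm → Tm → Tm
  subT c s (var i) = maybe var (plusT c s) (hitv c i)
  subT c s (up t)  = up (subT c s t)

  data Fm : Set where
    ap  : Tm → Tm → Fm
    eq  : Tm → Tm → Fm
    ⊥'  : Fm
    _⇒_ : Fm → Fm → Fm
    _∧_ : Fm → Fm → Fm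
    _∨_ : Fm → Fm → Fm
    ∀'  : ℕ → Fm → Fm
    ∃'  : ℕ → Fm → Fm

  ¬' : Fm → Fm
  ¬' φ = φ ⇒ ⊥'

  _⇔_ : Fm → Fm → Fm
  φ ⇔ ψ = (φ ⇒ ψ) ∧ (ψ ⇒ φ)

  wk : ℕ → Fm → Fm
  wk c (ap t s)  = ap (wkT c t) (wkT c s)
  wk c (eq t s)  = eq (wkT c t) (wkT c s)
  wk c ⊥'        = ⊥'
  wk c (φ ⇒ ψ)   = wk c φ ⇒ wk c ψ
  wk c (φ ∧ ψ)   = wk c φ ∧ wk c ψ
  wk c (φ ∨ ψ)   = wk c φ ∨ wk c ψ
  wk c (∀' n φ)  = ∀' n (wk (suc c) φ)
  wk c (∃' n φ)  = ∃' n (wk (suc c) φ)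

  sub : ℕ → Tm → Fm → Fm
  sub c u (ap t s)  = ap (subT c u t) (subT c u s)
  sub c u (eq t s)  = eq (subT c u t) (subT c u s)
  sub c u ⊥'        = ⊥'
  sub c u (φ ⇒ ψ)   = sub c u φ ⇒ sub c u ψ
  sub c u (φ ∧ ψ)   = sub c u φ ∧ sub c u ψ
  sub c u (φ ∨ ψ)   = sub c u φ ∨ sub c u ψ
  sub c u (∀' n φ)  = ∀' n (sub (suc c) u φ)
  sub c u (∃' n φ)  = ∃' n (sub (suc c) u φ)

  _[_] : Fm → Tm → Fm
  φ [ t ] = sub 0 t φ

  data WF (Δ : Ctx) : Fm → Set where
    ap  : ∀ {t s n} → Δ ⊢t t ∶ suc n → Δ ⊢t s ∶ n → WF Δ (ap t s)
    eq  : ∀ {t s n} → Δ ⊢t t ∶ n → Δ ⊢t s ∶ n → WF Δ (eq t s)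
    ⊥'  : WF Δ ⊥'
    _⇒_ : ∀ {φ ψ} → WF Δ φ → WF Δ ψ → WF Δ (φ ⇒ ψ)
    _∧_ : ∀ {φ ψ} → WF Δ φ → WF Δ ψ → WF Δ (φ ∧ ψ)
    _∨_ : ∀ {φ ψ} → WF Δ φ → WF Δ ψ → WF Δ (φ ∨ ψ)
    ∀'  : ∀ {n φ} → WF (n ∷ Δ) φ → WF Δ (∀' n φ)
    ∃'  : ∀ {n φ} → WF (n ∷ Δ) φ → WF Δ (∃' n φ)

  Comprehension : ℕ → Fm → Fm
  Comprehension n φ = ∃' (suc n) (∀' n (ap (var 1) (var 0) ⇔ wk 1 φ))

  -- ∀x^n ∀y^n (x = y ↔ ∀z^{n+1}(z(x) ↔ z(y)))
  IdScheme : ℕ → Fm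
  IdScheme n = ∀' n (∀' n (eq (var 1) (var 0)
                 ⇔ ∀' (suc n) (ap (var 0) (var 2) ⇔ ap (var 0) (var 1))))

  -- ∀x^n ∀y^n (↑x = ↑y → x = y)
  UpInject : ℕ → Fm
  UpInject n = ∀' n (∀' n (eq (up (var 1)) (up (var 0)) ⇒ eq (var 1) (var 0)))

  -- ∀x^n ∀y^{n+1} (↑y(↑x) ↔ y(x))
  UpPossess : ℕ → Fm
  UpPossess n = ∀' n (∀' (suc n) (ap (up (var 0)) (up (var 1)) ⇔ ap (var 0) (var 1)))

  -- ∀x^{n+1} ∀y^{n+1} (↑y(x) → ∃z^n x = ↑z)
  UpFounded : ℕ → Fm
  UpFounded n = ∀' (suc n) (∀' (suc n) (ap (up (var 0)) (var 1)
                  ⇒ ∃' n (eq (var 2) (up (var 0)))))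

  -- ∀x^0 ∀y^0 ¬ ↑y(x)
  UpBase : Fm
  UpBase = ∀' 0 (∀' 0 (¬' (ap (up (var 0)) (var 1))))

  infix 2 _∣_⊢_

  data _∣_⊢_ : Ctx → List Fm → Fm → Set where
    hyp  : ∀ {Δ Γ φ} → φ ∈ Γ → Δ ∣ Γ ⊢ φ
    ⊥E   : ∀ {Δ Γ φ} → WF Δ φ → Δ ∣ Γ ⊢ ⊥' → Δ ∣ Γ ⊢ φ
    raa  : ∀ {Δ Γ φ} → WF Δ φ → Δ ∣ ¬' φ ∷ Γ ⊢ ⊥' → Δ ∣ Γ ⊢ φ
    ⇒I   : ∀ {Δ Γ φ ψ} → WF Δ φ → Δ ∣ φ ∷ Γ ⊢ ψ → Δ ∣ Γ ⊢ φ ⇒ ψ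
    ⇒E   : ∀ {Δ Γ φ ψ} → Δ ∣ Γ ⊢ φ ⇒ ψ → Δ ∣ Γ ⊢ φ → Δ ∣ Γ ⊢ ψ
    ∧I   : ∀ {Δ Γ φ ψ} → Δ ∣ Γ ⊢ φ → Δ ∣ Γ ⊢ ψ → Δ ∣ Γ ⊢ φ ∧ ψ
    ∧E₁  : ∀ {Δ Γ φ ψ} → Δ ∣ Γ ⊢ φ ∧ ψ → Δ ∣ Γ ⊢ φ
    ∧E₂  : ∀ {Δ Γ φ ψ} → Δ ∣ Γ ⊢ φ ∧ ψ → Δ ∣ Γ ⊢ ψ
    ∨I₁  : ∀ {Δ Γ φ ψ} → WF Δ ψ → Δ ∣ Γ ⊢ φ → Δ ∣ Γ ⊢ φ ∨ ψ
    ∨I₂  : ∀ {Δ Γ φ ψ} → WF Δ φ → Δ ∣ Γ ⊢ ψ → Δ ∣ Γ ⊢ φ ∨ ψ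
    ∨E   : ∀ {Δ Γ φ ψ χ} → Δ ∣ Γ ⊢ φ ∨ ψ → Δ ∣ φ ∷ Γ ⊢ χ → Δ ∣ ψ ∷ Γ ⊢ χ
         → Δ ∣ Γ ⊢ χ
    ∀I   : ∀ {Δ Γ φ n} → (n ∷ Δ) ∣ map (wk 0) Γ ⊢ φ → Δ ∣ Γ ⊢ ∀' n φ
    ∀E   : ∀ {Δ Γ φ t n} → Δ ⊢t t ∶ n → Δ ∣ Γ ⊢ ∀' n φ → Δ ∣ Γ ⊢ φ [ t ]
    ∃I   : ∀ {Δ Γ φ t n} → Δ ⊢t t ∶ n → WF Δ (∃' n φ)
         → Δ ∣ Γ ⊢ φ [ t ] → Δ ∣ Γ ⊢ ∃' n φ
    ∃E   : ∀ {Δ Γ φ ψ n} → Δ ∣ Γ ⊢ ∃' n φ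
         → (n ∷ Δ) ∣ φ ∷ map (wk 0) Γ ⊢ wk 0 ψ → Δ ∣ Γ ⊢ ψ
    refl= : ∀ {Δ Γ t n} → Δ ⊢t t ∶ n → Δ ∣ Γ ⊢ eq t t
    subst= : ∀ {Δ Γ φ s t n} → WF (n ∷ Δ) φ → Δ ⊢t s ∶ n
           → Δ ∣ Γ ⊢ eq s t → Δ ∣ Γ ⊢ φ [ s ] → Δ ∣ Γ ⊢ φ [ t ]
    comp     : ∀ {Δ Γ φ n} → WF (n ∷ Δ) φ → Δ ∣ Γ ⊢ Comprehension n φ
    idScheme : ∀ {Δ Γ} n → Δ ∣ Γ ⊢ IdScheme n
    upInject  : ∀ {Δ Γ} n → Δ ∣ Γ ⊢ UpInject n
    upPossess : ∀ {Δ Γ} n → Δ ∣ Γ ⊢ UpPossess n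
    upFounded : ∀ {Δ Γ} n → Δ ∣ Γ ⊢ UpFounded n
    upBase    : ∀ {Δ Γ} → Δ ∣ Γ ⊢ UpBase

module C = CTT
module S = STT

-- type of variable i in Δ (default 0 outside Δ; irrelevant for
-- well-formed formulas)
ty : Ctx → ℕ → ℕ
ty []      _       = 0
ty (n ∷ Δ) zero    = n
ty (_ ∷ Δ) (suc i) = ty Δ i

-- a term ↑^k (var i) is represented by (k , i)
chain : S.Tm → ℕ × ℕ
chain (S.var i) = 0 , i
chain (S.up t)  = suc (proj₁ (chain t)) , proj₂ (chain t)

-- Russellian elimination of ↑x^n = ιu^{n+1}(x ≡ u) in ψ(u):
--   ∃u^{n+1} (∀v^{n+1}(x ≡ v ↔ v = u) ∧ ψ(u))
-- x is a variable of the current context; ψ is a body (u = index 0).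
desc : ℕ → ℕ → C.Fm → C.Fm
desc n x ψ = C.∃' (suc n) (C.∀' (suc n)
               (C.Equiv n (suc n) (suc (suc x)) 0 C.⇔ C.eq 0 1) C.∧ ψ)

-- eliminate the descriptions of ↑^k x (x of type n), innermost first;
-- the continuation K d y receives the number d of binders introduced
-- and the variable y denoting the value of ↑^k x.
elimUp : ℕ → ℕ → ℕ → (ℕ → ℕ → C.Fm) → C.Fm
elimUp n x zero    K = K 0 x
elimUp n x (suc k) K = desc n x (elimUp (suc n) 0 k (λ d y → K (suc d) y))

atomJ : Ctx → (ℕ → ℕ → C.Fm) → S.Tm → S.Tm → C.Fm
atomJ Δ R t s =
  elimUp (ty Δ (proj₂ (chain t))) (proj₂ (chain t)) (proj₁ (chain t)) λ d y →
  elimUp (ty Δ (proj₂ (chain s))) (proj₂ (chain s) + d) (proj₁ (chain s)) λ d′ z →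
  R (y + d′) z

J : Ctx → S.Fm → C.Fm
J Δ (S.ap t s)  = atomJ Δ C.ap t s
J Δ (S.eq t s)  = atomJ Δ C.eq t s
J Δ S.⊥'        = C.⊥'
J Δ (φ S.⇒ ψ)   = J Δ φ C.⇒ J Δ ψ
J Δ (φ S.∧ ψ)   = J Δ φ C.∧ J Δ ψ
J Δ (φ S.∨ ψ)   = J Δ φ C.∨ J Δ ψ
J Δ (S.∀' n φ)  = C.∀' n (J (n ∷ Δ) φ)
J Δ (S.∃' n φ)  = C.∃' n (J (n ∷ Δ) φ)

{-# OPTIONS --safe #-}
-- In CTT^ω every x^n has exactly one coextensive object at type n+1: x itself,
-- read at the higher type, is one, and two of them are identified by the
-- comprehension class {w : w = u}.  So the Russellian description ιu(x ≡ u) used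
-- for ↑x is proper, and it can be introduced and eliminated through any u with
-- ∀v(x ≡ v ↔ v = u).  Consequently J, although it does not commute with
-- substituting a term ↑^k x, does so up to provable equivalence once the value of
-- ↑^k x is named; this makes the quantifier and identity rules of STT^↑ sound.
-- The remaining rules translate verbatim, Comprehension goes to Comprehension,
-- the identity scheme is Leibniz identity, and the ↑-axioms reduce to facts about
-- ≡: Up-Inject and Up-Possess to the uniqueness and extensionality of coextensive
-- objects, Up-Founded to Type-Founded and Up-Base to Type-Base.
module Submission where

open import Defs
open import Data.List using (List; []; _∷_; map; _++_; length)
open import Data.Nat using (ℕ; zero; suc; _+_; _⊔_; _≤_; _<_; s≤s)
open import Data.Nat.Properties
  using (+-suc; +-comm; +-assoc; +-identityʳ; ≤-refl; ≤-trans; ≤-reflexive; n≤1+n; m≤m⊔n; m≤n⊔m; ⊔-comm; ⊔-idem)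
open import Data.Maybe using (just; nothing; maybe)
import Data.Maybe as Maybe
open import Data.Product using (_×_; _,_; proj₁; proj₂)
open import Relation.Binary.PropositionalEquality hiding (J)
open import Function using (_∘_; id)
open import Data.List.Membership.Propositional using (_∈_)
open import Data.List.Membership.Propositional.Properties using (∈-map⁺; ∈-map⁻)
open import Data.List.Properties using (map-cong; map-∘)
open import Data.List.Relation.Binary.Subset.Propositional using (_⊆_)
open import Data.List.Relation.Binary.Subset.Propositional.Properties using (map⁺; ∷⁺ʳ)
open import Data.List.Relation.Unary.Any using (here; there)

Ren : Set
Ren = ℕ → ℕ

lift : Ren → Ren
lift ρ zero    = zero
lift ρ (suc i) = suc (ρ i)

liftN : ℕ → Ren → Ren
liftN zero    ρ = ρ
liftN (suc d) ρ = liftN d (lift ρ)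

ren : Ren → C.Fm → C.Fm
ren ρ (C.ap y x) = C.ap (ρ y) (ρ x)
ren ρ (C.eq a b) = C.eq (ρ a) (ρ b)
ren ρ C.⊥'       = C.⊥'
ren ρ (φ C.⇒ ψ)  = ren ρ φ C.⇒ ren ρ ψ
ren ρ (φ C.∧ ψ)  = ren ρ φ C.∧ ren ρ ψ
ren ρ (φ C.∨ ψ)  = ren ρ φ C.∨ ren ρ ψ
ren ρ (C.∀' n φ) = C.∀' n (ren (lift ρ) φ)
ren ρ (C.∃' n φ) = C.∃' n (ren (lift ρ) φ)

lift-ext : ∀ {ρ σ} → ρ ≗ σ → lift ρ ≗ lift σ
lift-ext e zero    = refl
lift-ext e (suc i) = cong suc (e i)

ren-ext : ∀ {ρ σ} → ρ ≗ σ → ∀ φ → ren ρ φ ≡ ren σ φ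
ren-ext e (C.ap y x) = cong₂ C.ap (e y) (e x)
ren-ext e (C.eq a b) = cong₂ C.eq (e a) (e b)
ren-ext e C.⊥'       = refl
ren-ext e (φ C.⇒ ψ)  = cong₂ C._⇒_ (ren-ext e φ) (ren-ext e ψ)
ren-ext e (φ C.∧ ψ)  = cong₂ C._∧_ (ren-ext e φ) (ren-ext e ψ)
ren-ext e (φ C.∨ ψ)  = cong₂ C._∨_ (ren-ext e φ) (ren-ext e ψ)
ren-ext e (C.∀' n φ) = cong (C.∀' n) (ren-ext (lift-ext e) φ)
ren-ext e (C.∃' n φ) = cong (C.∃' n) (ren-ext (lift-ext e) φ)

lift-∘ : ∀ ρ σ i → lift ρ (lift σ i) ≡ lift (ρ ∘ σ) i
lift-∘ ρ σ zero    = refl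
lift-∘ ρ σ (suc i) = refl

ren-∘ : ∀ ρ σ φ → ren ρ (ren σ φ) ≡ ren (ρ ∘ σ) φ
ren-∘ ρ σ (C.ap y x) = refl
ren-∘ ρ σ (C.eq a b) = refl
ren-∘ ρ σ C.⊥'       = refl
ren-∘ ρ σ (φ C.⇒ ψ)  = cong₂ C._⇒_ (ren-∘ ρ σ φ) (ren-∘ ρ σ ψ)
ren-∘ ρ σ (φ C.∧ ψ)  = cong₂ C._∧_ (ren-∘ ρ σ φ) (ren-∘ ρ σ ψ)
ren-∘ ρ σ (φ C.∨ ψ)  = cong₂ C._∨_ (ren-∘ ρ σ φ) (ren-∘ ρ σ ψ)
ren-∘ ρ σ (C.∀' n φ) = cong (C.∀' n) (trans (ren-∘ (lift ρ) (lift σ) φ) (ren-ext (lift-∘ ρ σ) φ))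
ren-∘ ρ σ (C.∃' n φ) = cong (C.∃' n) (trans (ren-∘ (lift ρ) (lift σ) φ) (ren-ext (lift-∘ ρ σ) φ))

ren-id : ∀ {ρ} → ρ ≗ id → ∀ φ → ren ρ φ ≡ φ
ren-id e (C.ap y x) = cong₂ C.ap (e y) (e x)
ren-id e (C.eq a b) = cong₂ C.eq (e a) (e b)
ren-id e C.⊥'       = refl
ren-id e (φ C.⇒ ψ)  = cong₂ C._⇒_ (ren-id e φ) (ren-id e ψ)
ren-id e (φ C.∧ ψ)  = cong₂ C._∧_ (ren-id e φ) (ren-id e ψ)
ren-id e (φ C.∨ ψ)  = cong₂ C._∨_ (ren-id e φ) (ren-id e ψ)
ren-id e (C.∀' n φ) = cong (C.∀' n) (ren-id (λ { zero → refl ; (suc i) → cong suc (e i) }) φ)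
ren-id e (C.∃' n φ) = cong (C.∃' n) (ren-id (λ { zero → refl ; (suc i) → cong suc (e i) }) φ)

wkv-lift : ∀ c i → wkv (suc c) i ≡ lift (wkv c) i
wkv-lift c zero    = refl
wkv-lift c (suc i) = refl

wk-ren : ∀ c φ → C.wk c φ ≡ ren (wkv c) φ
wk-ren c (C.ap y x) = refl
wk-ren c (C.eq a b) = refl
wk-ren c C.⊥'       = refl
wk-ren c (φ C.⇒ ψ)  = cong₂ C._⇒_ (wk-ren c φ) (wk-ren c ψ)
wk-ren c (φ C.∧ ψ)  = cong₂ C._∧_ (wk-ren c φ) (wk-ren c ψ)
wk-ren c (φ C.∨ ψ)  = cong₂ C._∨_ (wk-ren c φ) (wk-ren c ψ)
wk-ren c (C.∀' n φ) = cong (C.∀' n) (trans (wk-ren (suc c) φ) (ren-ext (wkv-lift c) φ))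
wk-ren c (C.∃' n φ) = cong (C.∃' n) (trans (wk-ren (suc c) φ) (ren-ext (wkv-lift c) φ))

subv-lift : ∀ c a i → C.subv (suc c) a i ≡ lift (C.subv c a) i
subv-lift c a zero    = refl
subv-lift c a (suc i) with hitv c i
... | nothing = refl
... | just j  = refl

sub-ren : ∀ c a φ → C.sub c a φ ≡ ren (C.subv c a) φ
sub-ren c a (C.ap y x) = refl
sub-ren c a (C.eq x y) = refl
sub-ren c a C.⊥'       = refl
sub-ren c a (φ C.⇒ ψ)  = cong₂ C._⇒_ (sub-ren c a φ) (sub-ren c a ψ)
sub-ren c a (φ C.∧ ψ)  = cong₂ C._∧_ (sub-ren c a φ) (sub-ren c a ψ)
sub-ren c a (φ C.∨ ψ)  = cong₂ C._∨_ (sub-ren c a φ) (sub-ren c a ψ)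
sub-ren c a (C.∀' n φ) = cong (C.∀' n) (trans (sub-ren (suc c) a φ) (ren-ext (subv-lift c a) φ))
sub-ren c a (C.∃' n φ) = cong (C.∃' n) (trans (sub-ren (suc c) a φ) (ren-ext (subv-lift c a) φ))

ren-fuse : ∀ ρ σ τ φ → (∀ i → ρ (σ i) ≡ τ i) → ren ρ (ren σ φ) ≡ ren τ φ
ren-fuse ρ σ τ φ e = trans (ren-∘ ρ σ φ) (ren-ext e φ)

ren-sub0 : ∀ ρ φ a → ren ρ (φ C.[ a ]) ≡ (ren (lift ρ) φ) C.[ ρ a ]
ren-sub0 ρ φ a = begin
    ren ρ (C.sub 0 a φ)                    ≡⟨ cong (ren ρ) (sub-ren 0 a φ) ⟩
    ren ρ (ren (C.subv 0 a) φ)             ≡⟨ ren-fuse ρ _ _ φ (λ { zero → refl ; (suc i) → refl }) ⟩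
    ren (C.subv 0 (ρ a) ∘ lift ρ) φ        ≡⟨ sym (ren-∘ _ _ φ) ⟩
    ren (C.subv 0 (ρ a)) (ren (lift ρ) φ)  ≡⟨ sym (sub-ren 0 (ρ a) _) ⟩
    C.sub 0 (ρ a) (ren (lift ρ) φ) ∎
  where open ≡-Reasoning

ren-wk0 : ∀ ρ ψ → ren (lift ρ) (C.wk 0 ψ) ≡ C.wk 0 (ren ρ ψ)
ren-wk0 ρ ψ = trans (cong (ren (lift ρ)) (wk-ren 0 ψ))
              (trans (ren-fuse (lift ρ) (wkv 0) (suc ∘ ρ) ψ (λ i → refl))
              (trans (sym (ren-fuse (wkv 0) ρ (suc ∘ ρ) ψ (λ i → refl))) (sym (wk-ren 0 _))))

ren-wk1 : ∀ ρ ψ → ren (lift (lift ρ)) (C.wk 1 ψ) ≡ C.wk 1 (ren (lift ρ) ψ)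
ren-wk1 ρ ψ = trans (cong (ren (lift (lift ρ))) (wk-ren 1 ψ))
              (trans (ren-fuse _ (wkv 1) (wkv 1 ∘ lift ρ) ψ (λ { zero → refl ; (suc i) → refl }))
              (trans (sym (ren-∘ (wkv 1) (lift ρ) ψ)) (sym (wk-ren 1 _))))

sub-wk : ∀ c a d ψ → C.sub c a (C.wk d ψ) ≡ ren (C.subv c a ∘ wkv d) ψ
sub-wk c a d ψ = trans (sub-ren c a _) (trans (cong (ren (C.subv c a)) (wk-ren d ψ)) (ren-∘ _ _ ψ))

wk-sub : ∀ c a d ψ → C.wk d (C.sub c a ψ) ≡ ren (wkv d ∘ C.subv c a) ψ
wk-sub c a d ψ = trans (wk-ren d _) (trans (cong (ren (wkv d)) (sub-ren c a ψ)) (ren-∘ _ _ ψ))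

wk1-[0] : ∀ ψ → (C.wk 1 ψ) C.[ 0 ] ≡ ψ
wk1-[0] ψ = trans (sub-wk 0 0 1 ψ) (ren-id (λ { zero → refl ; (suc i) → refl }) ψ)

wk1-[suc] : ∀ ψ u → (C.wk 1 ψ) C.[ suc u ] ≡ C.wk 0 (ψ C.[ u ])
wk1-[suc] ψ u = trans (sub-wk 0 (suc u) 1 ψ)
  (trans (ren-ext (λ { zero → refl ; (suc i) → refl }) ψ) (sym (wk-sub 0 u 0 ψ)))

renT : Ren → S.Tm → S.Tm
renT ρ (S.var i) = S.var (ρ i)
renT ρ (S.up t)  = S.up (renT ρ t)

renS : Ren → S.Fm → S.Fm
renS ρ (S.ap t s)  = S.ap (renT ρ t) (renT ρ s)
renS ρ (S.eq t s)  = S.eq (renT ρ t) (renT ρ s)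
renS ρ S.⊥'        = S.⊥'
renS ρ (φ S.⇒ ψ)   = renS ρ φ S.⇒ renS ρ ψ
renS ρ (φ S.∧ ψ)   = renS ρ φ S.∧ renS ρ ψ
renS ρ (φ S.∨ ψ)   = renS ρ φ S.∨ renS ρ ψ
renS ρ (S.∀' n φ)  = S.∀' n (renS (lift ρ) φ)
renS ρ (S.∃' n φ)  = S.∃' n (renS (lift ρ) φ)

renT-ext : ∀ {ρ σ} → ρ ≗ σ → ∀ t → renT ρ t ≡ renT σ t
renT-ext e (S.var i) = cong S.var (e i)
renT-ext e (S.up t)  = cong S.up (renT-ext e t)

renS-ext : ∀ {ρ σ} → ρ ≗ σ → ∀ φ → renS ρ φ ≡ renS σ φ
renS-ext e (S.ap t s) = cong₂ S.ap (renT-ext e t) (renT-ext e s)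
renS-ext e (S.eq t s) = cong₂ S.eq (renT-ext e t) (renT-ext e s)
renS-ext e S.⊥'       = refl
renS-ext e (φ S.⇒ ψ)  = cong₂ S._⇒_ (renS-ext e φ) (renS-ext e ψ)
renS-ext e (φ S.∧ ψ)  = cong₂ S._∧_ (renS-ext e φ) (renS-ext e ψ)
renS-ext e (φ S.∨ ψ)  = cong₂ S._∨_ (renS-ext e φ) (renS-ext e ψ)
renS-ext e (S.∀' n φ) = cong (S.∀' n) (renS-ext (lift-ext e) φ)
renS-ext e (S.∃' n φ) = cong (S.∃' n) (renS-ext (lift-ext e) φ)

wkT-ren : ∀ c t → S.wkT c t ≡ renT (wkv c) t
wkT-ren c (S.var i) = refl
wkT-ren c (S.up t)  = cong S.up (wkT-ren c t)

wkS-ren : ∀ c φ → S.wk c φ ≡ renS (wkv c) φ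
wkS-ren c (S.ap t s) = cong₂ S.ap (wkT-ren c t) (wkT-ren c s)
wkS-ren c (S.eq t s) = cong₂ S.eq (wkT-ren c t) (wkT-ren c s)
wkS-ren c S.⊥'       = refl
wkS-ren c (φ S.⇒ ψ)  = cong₂ S._⇒_ (wkS-ren c φ) (wkS-ren c ψ)
wkS-ren c (φ S.∧ ψ)  = cong₂ S._∧_ (wkS-ren c φ) (wkS-ren c ψ)
wkS-ren c (φ S.∨ ψ)  = cong₂ S._∨_ (wkS-ren c φ) (wkS-ren c ψ)
wkS-ren c (S.∀' n φ) = cong (S.∀' n) (trans (wkS-ren (suc c) φ) (renS-ext (wkv-lift c) φ))
wkS-ren c (S.∃' n φ) = cong (S.∃' n) (trans (wkS-ren (suc c) φ) (renS-ext (wkv-lift c) φ))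

subTv-ren : ∀ c u t → S.subT c (S.var u) t ≡ renT (C.subv c u) t
subTv-ren c u (S.var i) with hitv c i
... | nothing = refl
... | just j  = refl
subTv-ren c u (S.up t) = cong S.up (subTv-ren c u t)

subSv-ren : ∀ c u φ → S.sub c (S.var u) φ ≡ renS (C.subv c u) φ
subSv-ren c u (S.ap t s) = cong₂ S.ap (subTv-ren c u t) (subTv-ren c u s)
subSv-ren c u (S.eq t s) = cong₂ S.eq (subTv-ren c u t) (subTv-ren c u s)
subSv-ren c u S.⊥'       = refl
subSv-ren c u (φ S.⇒ ψ)  = cong₂ S._⇒_ (subSv-ren c u φ) (subSv-ren c u ψ)
subSv-ren c u (φ S.∧ ψ)  = cong₂ S._∧_ (subSv-ren c u φ) (subSv-ren c u ψ)
subSv-ren c u (φ S.∨ ψ)  = cong₂ S._∨_ (subSv-ren c u φ) (subSv-ren c u ψ)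
subSv-ren c u (S.∀' n φ) = cong (S.∀' n) (trans (subSv-ren (suc c) u φ) (renS-ext (subv-lift c u) φ))
subSv-ren c u (S.∃' n φ) = cong (S.∃' n) (trans (subSv-ren (suc c) u φ) (renS-ext (subv-lift c u) φ))

chain-ren : ∀ ρ t → chain (renT ρ t) ≡ (proj₁ (chain t) , ρ (proj₂ (chain t)))
chain-ren ρ (S.var i) = refl
chain-ren ρ (S.up t)  = cong (λ p → suc (proj₁ p) , proj₂ p) (chain-ren ρ t)

elimUp-ext : ∀ n x k {K K' : ℕ → ℕ → C.Fm} → (∀ d y → K d y ≡ K' d y)
           → elimUp n x k K ≡ elimUp n x k K'
elimUp-ext n x zero    e = e 0 x
elimUp-ext n x (suc k) e = cong (desc n x) (elimUp-ext (suc n) 0 k (λ d y → e (suc d) y))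

elimUp-ren : ∀ ρ n x k (K K' : ℕ → ℕ → C.Fm)
           → (∀ d y → K' d (liftN d ρ y) ≡ ren (liftN d ρ) (K d y))
           → ren ρ (elimUp n x k K) ≡ elimUp n (ρ x) k K'
elimUp-ren ρ n x zero    K K' h = sym (h 0 x)
elimUp-ren ρ n x (suc k) K K' h =
  cong (desc n (ρ x)) (elimUp-ren (lift ρ) (suc n) 0 k (λ d y → K (suc d) y) (λ d y → K' (suc d) y)
                        (λ d y → h (suc d) y))

liftN-+ : ∀ d ρ i → liftN d ρ (i + d) ≡ ρ i + d
liftN-+ zero    ρ i = trans (cong ρ (+-identityʳ i)) (sym (+-identityʳ (ρ i)))
liftN-+ (suc d) ρ i = begin
    liftN d (lift ρ) (i + suc d) ≡⟨ cong (liftN d (lift ρ)) (+-suc i d) ⟩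
    liftN d (lift ρ) (suc i + d) ≡⟨ liftN-+ d (lift ρ) (suc i) ⟩
    suc (ρ i) + d                ≡⟨ sym (+-suc (ρ i) d) ⟩
    ρ i + suc d ∎
  where open ≡-Reasoning

atomOn : Ctx → (ℕ → ℕ → C.Fm) → ℕ × ℕ → ℕ × ℕ → C.Fm
atomOn Δ R p q =
  elimUp (ty Δ (proj₂ p)) (proj₂ p) (proj₁ p) λ d y →
  elimUp (ty Δ (proj₂ q)) (proj₂ q + d) (proj₁ q) λ d′ z →
  R (y + d′) z

RelRen : (ℕ → ℕ → C.Fm) → Set
RelRen R = ∀ σ p q → ren σ (R p q) ≡ R (σ p) (σ q)

PreservesTy : Ctx → Ctx → Ren → Set
PreservesTy Δ Δ' ρ = ∀ i → ty Δ' (ρ i) ≡ ty Δ i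

elimAtom : (ℕ → ℕ → C.Fm) → ℕ → ℕ → ℕ → ℕ → ℕ → ℕ → C.Fm
elimAtom R a x k b w j =
  elimUp a x k λ d y → elimUp b (w + d) j λ d′ z → R (y + d′) z

elimAtom-ren : ∀ ρ R → RelRen R
          → ∀ a x k b w j → ren ρ (elimAtom R a x k b w j) ≡ elimAtom R a (ρ x) k b (ρ w) j
elimAtom-ren ρ R Rr a x k b w j = elimUp-ren ρ a x k _ _ λ d y →
  sym (trans (elimUp-ren (liftN d ρ) b (w + d) j _ (λ d′ z → R (liftN d ρ y + d′) z)
               (λ d′ z → trans (cong (λ v → R v (liftN d′ (liftN d ρ) z)) (sym (liftN-+ d′ (liftN d ρ) y)))
                               (sym (Rr (liftN d′ (liftN d ρ)) (y + d′) z))))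
             (cong (λ v → elimUp b v j (λ d′ z → R (liftN d ρ y + d′) z)) (liftN-+ d ρ w)))

atomJ-ren : ∀ Δ Δ' ρ R → PreservesTy Δ Δ' ρ → RelRen R
          → ∀ t s → atomJ Δ' R (renT ρ t) (renT ρ s) ≡ ren ρ (atomJ Δ R t s)
atomJ-ren Δ Δ' ρ R tyeq Rr t s
  rewrite chain-ren ρ t | chain-ren ρ s
        | tyeq (proj₂ (chain t)) | tyeq (proj₂ (chain s)) =
  sym (elimAtom-ren ρ R Rr (ty Δ (proj₂ (chain t))) (proj₂ (chain t)) (proj₁ (chain t))
                         (ty Δ (proj₂ (chain s))) (proj₂ (chain s)) (proj₁ (chain s)))

ty-lift : ∀ Δ Δ' ρ n → PreservesTy Δ Δ' ρ → PreservesTy (n ∷ Δ) (n ∷ Δ') (lift ρ)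
ty-lift Δ Δ' ρ n e zero    = refl
ty-lift Δ Δ' ρ n e (suc i) = e i

J-ren : ∀ Δ Δ' ρ → PreservesTy Δ Δ' ρ → ∀ φ → J Δ' (renS ρ φ) ≡ ren ρ (J Δ φ)
J-ren Δ Δ' ρ e (S.ap t s) = atomJ-ren Δ Δ' ρ C.ap e (λ _ _ _ → refl) t s
J-ren Δ Δ' ρ e (S.eq t s) = atomJ-ren Δ Δ' ρ C.eq e (λ _ _ _ → refl) t s
J-ren Δ Δ' ρ e S.⊥'       = refl
J-ren Δ Δ' ρ e (φ S.⇒ ψ)  = cong₂ C._⇒_ (J-ren Δ Δ' ρ e φ) (J-ren Δ Δ' ρ e ψ)
J-ren Δ Δ' ρ e (φ S.∧ ψ)  = cong₂ C._∧_ (J-ren Δ Δ' ρ e φ) (J-ren Δ Δ' ρ e ψ)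
J-ren Δ Δ' ρ e (φ S.∨ ψ)  = cong₂ C._∨_ (J-ren Δ Δ' ρ e φ) (J-ren Δ Δ' ρ e ψ)
J-ren Δ Δ' ρ e (S.∀' n φ) = cong (C.∀' n) (J-ren (n ∷ Δ) (n ∷ Δ') (lift ρ) (ty-lift Δ Δ' ρ n e) φ)
J-ren Δ Δ' ρ e (S.∃' n φ) = cong (C.∃' n) (J-ren (n ∷ Δ) (n ∷ Δ') (lift ρ) (ty-lift Δ Δ' ρ n e) φ)

J-wk0 : ∀ Δ n φ → J (n ∷ Δ) (S.wk 0 φ) ≡ C.wk 0 (J Δ φ)
J-wk0 Δ n φ = trans (cong (J (n ∷ Δ)) (wkS-ren 0 φ))
              (trans (J-ren Δ (n ∷ Δ) (wkv 0) (λ i → refl) φ) (sym (wk-ren 0 (J Δ φ))))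

ty-wk1 : ∀ Δ n m → PreservesTy (n ∷ Δ) (n ∷ m ∷ Δ) (wkv 1)
ty-wk1 Δ n m zero    = refl
ty-wk1 Δ n m (suc i) = refl

J-wk1 : ∀ Δ n m φ → J (n ∷ m ∷ Δ) (S.wk 1 φ) ≡ C.wk 1 (J (n ∷ Δ) φ)
J-wk1 Δ n m φ = trans (cong (J (n ∷ m ∷ Δ)) (wkS-ren 1 φ))
              (trans (J-ren (n ∷ Δ) (n ∷ m ∷ Δ) (wkv 1) (ty-wk1 Δ n m) φ) (sym (wk-ren 1 (J (n ∷ Δ) φ))))

open C using (_∣_⊢_)

weakenΓ : ∀ {Δ Γ Γ' φ} → Γ ⊆ Γ' → Δ ∣ Γ ⊢ φ → Δ ∣ Γ' ⊢ φ
weakenΓ s (C.hyp x) = C.hyp (s x)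
weakenΓ s (C.⊥E x d) = C.⊥E x (weakenΓ s d)
weakenΓ s (C.raa x d) = C.raa x (weakenΓ (∷⁺ʳ _ s) d)
weakenΓ s (C.⇒I x d) = C.⇒I x (weakenΓ (∷⁺ʳ _ s) d)
weakenΓ s (C.⇒E d d₁) = C.⇒E (weakenΓ s d) (weakenΓ s d₁)
weakenΓ s (C.∧I d d₁) = C.∧I (weakenΓ s d) (weakenΓ s d₁)
weakenΓ s (C.∧E₁ d) = C.∧E₁ (weakenΓ s d)
weakenΓ s (C.∧E₂ d) = C.∧E₂ (weakenΓ s d)
weakenΓ s (C.∨I₁ x d) = C.∨I₁ x (weakenΓ s d)
weakenΓ s (C.∨I₂ x d) = C.∨I₂ x (weakenΓ s d)
weakenΓ s (C.∨E d d₁ d₂) = C.∨E (weakenΓ s d) (weakenΓ (∷⁺ʳ _ s) d₁) (weakenΓ (∷⁺ʳ _ s) d₂)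
weakenΓ s (C.∀I x x₁ d) = C.∀I x x₁ (weakenΓ (map⁺ _ s) d)
weakenΓ s (C.∀E x x₁ x₂ d) = C.∀E x x₁ x₂ (weakenΓ s d)
weakenΓ s (C.∃I x x₁ x₂ d) = C.∃I x x₁ x₂ (weakenΓ s d)
weakenΓ s (C.∃E x x₁ d d₁) = C.∃E x x₁ (weakenΓ s d) (weakenΓ (∷⁺ʳ _ (map⁺ _ s)) d₁)
weakenΓ s (C.refl= x) = C.refl= x
weakenΓ s (C.subst= x x₁ d d₁) = C.subst= x x₁ (weakenΓ s d) (weakenΓ s d₁)
weakenΓ s (C.comp x) = C.comp x
weakenΓ s (C.typeFounded m n) = C.typeFounded m n
weakenΓ s (C.typeBase m) = C.typeBase m

wkΓ : ∀ {Δ Γ φ ψ} → Δ ∣ Γ ⊢ φ → Δ ∣ ψ ∷ Γ ⊢ φ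
wkΓ = weakenΓ there

wf-≡ : ∀ {Δ φ ψ} → φ ≡ ψ → C.WF Δ φ → C.WF Δ ψ
wf-≡ refl w = w

⊢-≡ : ∀ {Δ Γ φ ψ} → φ ≡ ψ → Δ ∣ Γ ⊢ φ → Δ ∣ Γ ⊢ ψ
⊢-≡ refl d = d

ctx-≡ : ∀ {Δ Γ Γ' φ} → Γ ≡ Γ' → Δ ∣ Γ ⊢ φ → Δ ∣ Γ' ⊢ φ
ctx-≡ refl d = d

TyRen : Ctx → Ctx → Ren → Set
TyRen Δ Δ' ρ = ∀ {i n} → Δ ∋ i ∶ n → Δ' ∋ ρ i ∶ n

tyren-lift : ∀ {Δ Δ' ρ} m → TyRen Δ Δ' ρ → TyRen (m ∷ Δ) (m ∷ Δ') (lift ρ)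
tyren-lift m f here = here
tyren-lift m f (there p) = there (f p)

wf-ren : ∀ {Δ Δ' ρ} → TyRen Δ Δ' ρ → ∀ {φ} → C.WF Δ φ → C.WF Δ' (ren ρ φ)
wf-ren f (C.ap p q l) = C.ap (f p) (f q) l
wf-ren f (C.eq p q) = C.eq (f p) (f q)
wf-ren f C.⊥' = C.⊥'
wf-ren f (w C.⇒ w₁) = wf-ren f w C.⇒ wf-ren f w₁
wf-ren f (w C.∧ w₁) = wf-ren f w C.∧ wf-ren f w₁
wf-ren f (w C.∨ w₁) = wf-ren f w C.∨ wf-ren f w₁
wf-ren f (C.∀' w) = C.∀' (wf-ren (tyren-lift _ f) w)
wf-ren f (C.∃' w) = C.∃' (wf-ren (tyren-lift _ f) w)

tyren-wk1 : ∀ {Δ n m} → TyRen (n ∷ Δ) (n ∷ m ∷ Δ) (wkv 1)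
tyren-wk1 here = here
tyren-wk1 (there p) = there (there p)

wf-wk1 : ∀ {Δ n m ψ} → C.WF (n ∷ Δ) ψ → C.WF (n ∷ m ∷ Δ) (C.wk 1 ψ)
wf-wk1 {ψ = ψ} w = wf-≡ (sym (wk-ren 1 ψ)) (wf-ren tyren-wk1 w)

tyren-sub0 : ∀ {Δ a n} → Δ ∋ a ∶ n → TyRen (n ∷ Δ) Δ (C.subv 0 a)
tyren-sub0 p here = p
tyren-sub0 p (there q) = q

wf-sub0 : ∀ {Δ a n φ} → Δ ∋ a ∶ n → C.WF (n ∷ Δ) φ → C.WF Δ (φ C.[ a ])
wf-sub0 {φ = φ} p w = wf-≡ (sym (sub-ren 0 _ φ)) (wf-ren (tyren-sub0 p) w)

⇔I : ∀ {Δ Γ φ ψ} → C.WF Δ φ → C.WF Δ ψ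
   → Δ ∣ φ ∷ Γ ⊢ ψ → Δ ∣ ψ ∷ Γ ⊢ φ → Δ ∣ Γ ⊢ φ C.⇔ ψ
⇔I wφ wψ d e = C.∧I (C.⇒I wφ d) (C.⇒I wψ e)

⇔→ : ∀ {Δ Γ φ ψ} → Δ ∣ Γ ⊢ φ C.⇔ ψ → Δ ∣ Γ ⊢ φ → Δ ∣ Γ ⊢ ψ
⇔→ d e = C.⇒E (C.∧E₁ d) e

⇔← : ∀ {Δ Γ φ ψ} → Δ ∣ Γ ⊢ φ C.⇔ ψ → Δ ∣ Γ ⊢ ψ → Δ ∣ Γ ⊢ φ
⇔← d e = C.⇒E (C.∧E₂ d) e

hyp₀ : ∀ {Δ Γ φ} → Δ ∣ φ ∷ Γ ⊢ φ
hyp₀ = C.hyp (here refl)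

hyp₁ : ∀ {Δ Γ φ ψ} → Δ ∣ ψ ∷ φ ∷ Γ ⊢ φ
hyp₁ = C.hyp (there (here refl))

=-sym : ∀ {Δ Γ a b n} → Δ ∋ a ∶ n → Δ ∣ Γ ⊢ C.eq a b → Δ ∣ Γ ⊢ C.eq b a
=-sym {a = a} p d = C.subst= {φ = C.eq 0 (suc a)} (C.eq here (there p)) p d (C.refl= p)

wf-⇔ : ∀ {Δ φ ψ} → C.WF Δ φ → C.WF Δ ψ → C.WF Δ (φ C.⇔ ψ)
wf-⇔ a b = (a C.⇒ b) C.∧ (b C.⇒ a)

∀I-same : ∀ {Δ Γ φ m} → C.WF (m ∷ Δ) φ → (m ∷ Δ) ∣ map (C.wk 0) Γ ⊢ φ → Δ ∣ Γ ⊢ C.∀' m φ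
∀I-same = C.∀I ≤-refl

∃E-same : ∀ {Δ Γ φ ψ m} → C.WF (m ∷ Δ) φ → Δ ∣ Γ ⊢ C.∃' m φ
    → (m ∷ Δ) ∣ φ ∷ map (C.wk 0) Γ ⊢ C.wk 0 ψ → Δ ∣ Γ ⊢ ψ
∃E-same = C.∃E ≤-refl

⇔-refl : ∀ {Δ Γ φ} → C.WF Δ φ → Δ ∣ Γ ⊢ φ C.⇔ φ
⇔-refl w = ⇔I w w hyp₀ hyp₀

⇔-trans : ∀ {Δ Γ φ ψ χ} → C.WF Δ φ → C.WF Δ χ
        → Δ ∣ Γ ⊢ φ C.⇔ ψ → Δ ∣ Γ ⊢ ψ C.⇔ χ → Δ ∣ Γ ⊢ φ C.⇔ χ
⇔-trans w1 w3 d e = ⇔I w1 w3 (⇔→ (wkΓ e) (⇔→ (wkΓ d) hyp₀)) (⇔← (wkΓ d) (⇔← (wkΓ e) hyp₀))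

⇔-sym : ∀ {Δ Γ φ ψ} → Δ ∣ Γ ⊢ φ C.⇔ ψ → Δ ∣ Γ ⊢ ψ C.⇔ φ
⇔-sym d = C.∧I (C.∧E₂ d) (C.∧E₁ d)

⇔-cong-⇒ : ∀ {Δ Γ A1 A2 B1 B2} → C.WF Δ A1 → C.WF Δ A2 → C.WF Δ B1 → C.WF Δ B2
     → Δ ∣ Γ ⊢ A1 C.⇔ A2 → Δ ∣ Γ ⊢ B1 C.⇔ B2 → Δ ∣ Γ ⊢ (A1 C.⇒ B1) C.⇔ (A2 C.⇒ B2)
⇔-cong-⇒ wa1 wa2 wb1 wb2 dA dB =
  ⇔I (wa1 C.⇒ wb1) (wa2 C.⇒ wb2)
    (C.⇒I wa2 (⇔→ (wkΓ (wkΓ dB)) (C.⇒E hyp₁ (⇔← (wkΓ (wkΓ dA)) hyp₀))))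
    (C.⇒I wa1 (⇔← (wkΓ (wkΓ dB)) (C.⇒E hyp₁ (⇔→ (wkΓ (wkΓ dA)) hyp₀))))

⇔-cong-∧ : ∀ {Δ Γ A1 A2 B1 B2} → C.WF Δ A1 → C.WF Δ A2 → C.WF Δ B1 → C.WF Δ B2
     → Δ ∣ Γ ⊢ A1 C.⇔ A2 → Δ ∣ Γ ⊢ B1 C.⇔ B2 → Δ ∣ Γ ⊢ (A1 C.∧ B1) C.⇔ (A2 C.∧ B2)
⇔-cong-∧ wa1 wa2 wb1 wb2 dA dB =
  ⇔I (wa1 C.∧ wb1) (wa2 C.∧ wb2)
    (C.∧I (⇔→ (wkΓ dA) (C.∧E₁ hyp₀)) (⇔→ (wkΓ dB) (C.∧E₂ hyp₀)))
    (C.∧I (⇔← (wkΓ dA) (C.∧E₁ hyp₀)) (⇔← (wkΓ dB) (C.∧E₂ hyp₀)))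

⇔-cong-∨ : ∀ {Δ Γ A1 A2 B1 B2} → C.WF Δ A1 → C.WF Δ A2 → C.WF Δ B1 → C.WF Δ B2
     → Δ ∣ Γ ⊢ A1 C.⇔ A2 → Δ ∣ Γ ⊢ B1 C.⇔ B2 → Δ ∣ Γ ⊢ (A1 C.∨ B1) C.⇔ (A2 C.∨ B2)
⇔-cong-∨ wa1 wa2 wb1 wb2 dA dB =
  ⇔I (wa1 C.∨ wb1) (wa2 C.∨ wb2)
    (C.∨E hyp₀ (C.∨I₁ wb2 (⇔→ (wkΓ (wkΓ dA)) hyp₀)) (C.∨I₂ wa2 (⇔→ (wkΓ (wkΓ dB)) hyp₀)))
    (C.∨E hyp₀ (C.∨I₁ wb1 (⇔← (wkΓ (wkΓ dA)) hyp₀)) (C.∨I₂ wa1 (⇔← (wkΓ (wkΓ dB)) hyp₀)))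

∀E-here : ∀ {Δ Γ m A} → C.WF (m ∷ Δ) A → (m ∷ Δ) ∣ Γ ⊢ C.wk 0 (C.∀' m A) → (m ∷ Δ) ∣ Γ ⊢ A
∀E-here {A = A} w d = ⊢-≡ (wk1-[0] A) (C.∀E ≤-refl here (wf-≡ (sym (wk1-[0] A)) w) d)

⇔-cong-∀ : ∀ {Δ Γ m A B} → C.WF (m ∷ Δ) A → C.WF (m ∷ Δ) B
     → (m ∷ Δ) ∣ map (C.wk 0) Γ ⊢ A C.⇔ B → Δ ∣ Γ ⊢ C.∀' m A C.⇔ C.∀' m B
⇔-cong-∀ wa wb d =
  ⇔I (C.∀' wa) (C.∀' wb)
    (∀I-same wb (⇔→ (wkΓ d) (∀E-here wa hyp₀)))
    (∀I-same wa (⇔← (wkΓ d) (∀E-here wb hyp₀)))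

∃I-here : ∀ {Δ Γ m A} → C.WF (m ∷ Δ) A → (m ∷ Δ) ∣ Γ ⊢ A → (m ∷ Δ) ∣ Γ ⊢ C.wk 0 (C.∃' m A)
∃I-here {A = A} w d = C.∃I {φ = C.wk 1 A} ≤-refl here (C.∃' (wf-wk1 w)) (⊢-≡ (sym (wk1-[0] A)) d)

⇔-cong-∃ : ∀ {Δ Γ m A B} → C.WF (m ∷ Δ) A → C.WF (m ∷ Δ) B
     → (m ∷ Δ) ∣ map (C.wk 0) Γ ⊢ A C.⇔ B → Δ ∣ Γ ⊢ C.∃' m A C.⇔ C.∃' m B
⇔-cong-∃ wa wb d =
  ⇔I (C.∃' wa) (C.∃' wb)
    (∃E-same wa hyp₀ (∃I-here wb (⇔→ (wkΓ (wkΓ d)) hyp₀)))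
    (∃E-same wb hyp₀ (∃I-here wa (⇔← (wkΓ (wkΓ d)) hyp₀)))

map-ren-wk0 : ∀ ρ Γ → map (ren (lift ρ)) (map (C.wk 0) Γ) ≡ map (C.wk 0) (map (ren ρ) Γ)
map-ren-wk0 ρ Γ = trans (sym (map-∘ Γ)) (trans (map-cong (ren-wk0 ρ) Γ) (map-∘ Γ))

ren-⊢ : ∀ {Δ Δ' ρ Γ φ} → TyRen Δ Δ' ρ → Δ ∣ Γ ⊢ φ → Δ' ∣ map (ren ρ) Γ ⊢ ren ρ φ
ren-⊢ f (C.hyp x) = C.hyp (∈-map⁺ _ x)
ren-⊢ f (C.⊥E w d) = C.⊥E (wf-ren f w) (ren-⊢ f d)
ren-⊢ f (C.raa w d) = C.raa (wf-ren f w) (ren-⊢ f d)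
ren-⊢ f (C.⇒I w d) = C.⇒I (wf-ren f w) (ren-⊢ f d)
ren-⊢ f (C.⇒E d e) = C.⇒E (ren-⊢ f d) (ren-⊢ f e)
ren-⊢ f (C.∧I d e) = C.∧I (ren-⊢ f d) (ren-⊢ f e)
ren-⊢ f (C.∧E₁ d) = C.∧E₁ (ren-⊢ f d)
ren-⊢ f (C.∧E₂ d) = C.∧E₂ (ren-⊢ f d)
ren-⊢ f (C.∨I₁ w d) = C.∨I₁ (wf-ren f w) (ren-⊢ f d)
ren-⊢ f (C.∨I₂ w d) = C.∨I₂ (wf-ren f w) (ren-⊢ f d)
ren-⊢ f (C.∨E d e e') = C.∨E (ren-⊢ f d) (ren-⊢ f e) (ren-⊢ f e')
ren-⊢ {ρ = ρ} {Γ = Γ} f (C.∀I le w d) =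
  C.∀I le (wf-ren (tyren-lift _ f) w) (ctx-≡ (map-ren-wk0 ρ Γ) (ren-⊢ (tyren-lift _ f) d))
ren-⊢ {ρ = ρ} f (C.∀E {φ = φ} {a = a} le p w d) =
  ⊢-≡ (sym (ren-sub0 ρ φ a)) (C.∀E le (f p) (wf-≡ (ren-sub0 ρ φ a) (wf-ren f w)) (ren-⊢ f d))
ren-⊢ {ρ = ρ} f (C.∃I {φ = φ} {a = a} le p w d) =
  C.∃I le (f p) (wf-ren f w) (⊢-≡ (ren-sub0 ρ φ a) (ren-⊢ f d))
ren-⊢ {ρ = ρ} {Γ = Γ} f (C.∃E {ψ = ψ} le w d e) =
  C.∃E le (wf-ren (tyren-lift _ f) w) (ren-⊢ f d)
    (⊢-≡ (ren-wk0 ρ ψ) (ctx-≡ (cong (_ ∷_) (map-ren-wk0 ρ Γ)) (ren-⊢ (tyren-lift _ f) e)))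
ren-⊢ f (C.refl= p) = C.refl= (f p)
ren-⊢ {ρ = ρ} f (C.subst= {φ = φ} {a = a} {b = b} w p d e) =
  ⊢-≡ (sym (ren-sub0 ρ φ b))
    (C.subst= (wf-ren (tyren-lift _ f) w) (f p) (ren-⊢ f d) (⊢-≡ (ren-sub0 ρ φ a) (ren-⊢ f e)))
ren-⊢ {ρ = ρ} f (C.comp {φ = φ} w) =
  ⊢-≡ (cong (λ z → C.∃' _ (C.∀' _ (C.ap 1 0 C.⇔ z))) (sym (ren-wk1 ρ φ)))
      (C.comp (wf-ren (tyren-lift _ f) w))
ren-⊢ f (C.typeFounded m n) = C.typeFounded m n
ren-⊢ f (C.typeBase m) = C.typeBase m

wk-⊢ : ∀ {Δ Γ φ} m → Δ ∣ Γ ⊢ φ → (m ∷ Δ) ∣ map (C.wk 0) Γ ⊢ C.wk 0 φ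
wk-⊢ {Γ = Γ} {φ} m d =
  ⊢-≡ (sym (wk-ren 0 φ)) (ctx-≡ (map-cong (sym ∘ wk-ren 0) Γ) (ren-⊢ there d))

-- Coextension and the description of ↑

Leibniz : ℕ → ℕ → ℕ → C.Fm
Leibniz T a b = C.∀' T (C.ap 0 (suc a) C.⇔ C.ap 0 (suc b))

IsUp : ℕ → ℕ → ℕ → C.Fm
IsUp n x u = C.∀' (suc n) (C.Equiv n (suc n) (suc x) 0 C.⇔ C.eq 0 (suc u))

wf-Leibniz : ∀ {Δ a b p q T} → Δ ∋ a ∶ p → Δ ∋ b ∶ q → p < T → q < T → C.WF Δ (Leibniz T a b)
wf-Leibniz pa pb la lb = C.∀' (wf-⇔ (C.ap here (there pa) la) (C.ap here (there pb) lb))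

wf-Equiv : ∀ {Δ a b m n} → Δ ∋ a ∶ m → Δ ∋ b ∶ n → C.WF Δ (C.Equiv m n a b)
wf-Equiv {m = m} {n} pa pb = wf-Leibniz pa pb (s≤s (m≤m⊔n m n)) (s≤s (m≤n⊔m m n))

wf-IsUp : ∀ {Δ n x u} → Δ ∋ x ∶ n → Δ ∋ u ∶ suc n → C.WF Δ (IsUp n x u)
wf-IsUp px pu = C.∀' (wf-⇔ (wf-Equiv (there px) here) (C.eq here (there pu)))

wf-Elem : ∀ {Δ a b m n} → Δ ∋ a ∶ m → Δ ∋ b ∶ n → C.WF Δ (C.Elem m n a b)
wf-Elem {m = m} {n} pa pb = C.∃' (wf-Equiv here (there pb) C.∧ C.ap here (there pa) (s≤s (m≤m⊔n m n)))

Leibniz-at : ∀ {Δ Γ a b z m n p T} → Δ ∋ z ∶ p → p ≤ T → m < p → n < p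
           → Δ ∋ a ∶ m → Δ ∋ b ∶ n → Δ ∣ Γ ⊢ Leibniz T a b → Δ ∣ Γ ⊢ C.ap z a C.⇔ C.ap z b
Leibniz-at pz le la lb pa pb = C.∀E le pz (wf-⇔ (C.ap pz pa la) (C.ap pz pb lb))

Leibniz-refl : ∀ {Δ Γ a p T} → Δ ∋ a ∶ p → p < T → Δ ∣ Γ ⊢ Leibniz T a a
Leibniz-refl pa la = ∀I-same (wf-⇔ w w) (⇔-refl w)
  where w = C.ap here (there pa) la

-- Restricting the quantifier to a lower type is where cumulativity enters.
Leibniz-sym : ∀ {Δ Γ a b p q T T′} → Δ ∋ a ∶ p → Δ ∋ b ∶ q → p < T′ → q < T′ → T′ ≤ T
            → Δ ∣ Γ ⊢ Leibniz T a b → Δ ∣ Γ ⊢ Leibniz T′ b a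
Leibniz-sym {T′ = T′} pa pb la lb le d =
  ∀I-same (wf-⇔ (C.ap here (there pb) lb) (C.ap here (there pa) la))
    (⇔-sym (Leibniz-at here le la lb (there pa) (there pb) (wk-⊢ T′ d)))

eq⇒Leibniz : ∀ {Δ Γ a b n T} → Δ ∋ a ∶ n → Δ ∋ b ∶ n → n < T
           → Δ ∣ Γ ⊢ C.eq a b → Δ ∣ Γ ⊢ Leibniz T a b
eq⇒Leibniz {a = a} {T = T} pa pb l d =
  C.subst= {φ = Leibniz T (suc a) 0} (wf-Leibniz (there pa) here l l) pa d (Leibniz-refl pa l)

-- The comprehension class {w : w = x} separates x from every y ≠ x.
Leibniz⇒eq : ∀ {Δ Γ x y n T} → Δ ∋ x ∶ n → Δ ∋ y ∶ n → suc n ≤ T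
           → Δ ∣ Γ ⊢ Leibniz T x y → Δ ∣ Γ ⊢ C.eq x y
Leibniz⇒eq {x = x} {n = n} px py le d =
  ∃E-same (C.∀' (wf-⇔ (C.ap (there here) here ≤-refl) (C.eq here (there (there px)))))
    (C.comp {φ = C.eq 0 (suc x)} (C.eq here (there px)))
    (=-sym (there py)
      (⇔→ (member (there py))
        (⇔→ (Leibniz-at here le ≤-refl ≤-refl (there px) (there py) (wkΓ (wk-⊢ (suc n) d)))
          (⇔← (member (there px)) (C.refl= (there px))))))
  where
    member : ∀ {Γ′ w} → _ ∋ w ∶ n → _ ∣ C.∀' n (C.ap 1 0 C.⇔ C.eq 0 (suc (suc x))) ∷ Γ′
                                     ⊢ C.ap 0 w C.⇔ C.eq w (suc x)
    member pw = C.∀E ≤-refl pw (wf-⇔ (C.ap here pw ≤-refl) (C.eq pw (there px))) hyp₀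

Equiv-sym : ∀ {Δ Γ a b m n} → Δ ∋ a ∶ m → Δ ∋ b ∶ n
          → Δ ∣ Γ ⊢ C.Equiv m n a b → Δ ∣ Γ ⊢ C.Equiv n m b a
Equiv-sym {m = m} {n} pa pb =
  Leibniz-sym pa pb (s≤s (m≤n⊔m n m)) (s≤s (m≤m⊔n n m)) (≤-reflexive (cong suc (⊔-comm n m)))

-- Compare a and b through the comprehension class {w : w(c)}.
Equiv-members : ∀ {Δ Γ a b c m n p} → Δ ∋ a ∶ m → Δ ∋ b ∶ n → Δ ∋ c ∶ p → p < m → p < n
              → Δ ∣ Γ ⊢ C.Equiv m n a b → Δ ∣ Γ ⊢ C.ap a c C.⇔ C.ap b c
Equiv-members {Δ} {a = a} {b} {c} {m} {n} pa pb pc lm ln d =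
  ∃E-same (C.∀' (wf-⇔ (C.ap (there here) here ≤-refl) (C.ap here (there (there pc)) p<k)))
    (C.comp {φ = C.ap 0 (suc c)} (C.ap here (there pc) p<k))
    (⇔-trans wa wb (⇔-sym (member (m≤m⊔n m n) (there pa) lm))
      (⇔-trans (C.ap here (there pa) (s≤s (m≤m⊔n m n))) wb
        (Leibniz-at here ≤-refl (s≤s (m≤m⊔n m n)) (s≤s (m≤n⊔m m n)) (there pa) (there pb)
          (wkΓ (wk-⊢ _ d)))
        (member (m≤n⊔m m n) (there pb) ln)))
  where
    k = m ⊔ n
    p<k = ≤-trans lm (m≤m⊔n m n)
    wa : C.WF (suc k ∷ Δ) (C.ap (suc a) (suc c))
    wa = C.ap (there pa) (there pc) lm
    wb : C.WF (suc k ∷ Δ) (C.ap (suc b) (suc c))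
    wb = C.ap (there pb) (there pc) ln
    member : ∀ {Γ′ w q} → q ≤ k → (suc k ∷ Δ) ∋ w ∶ q → _ < q
           → (suc k ∷ Δ) ∣ C.∀' k (C.ap 1 0 C.⇔ C.ap 0 (suc (suc c))) ∷ Γ′
             ⊢ C.ap 0 w C.⇔ C.ap w (suc c)
    member le pw lw = C.∀E le pw (wf-⇔ (C.ap here pw (s≤s le)) (C.ap pw (there pc) lw)) hyp₀

n<ssn : ∀ n → n < suc (suc n)
n<ssn n = s≤s (n≤1+n n)

ssn≤ : ∀ n → suc (suc n) ≤ suc (n ⊔ suc n)
ssn≤ n = s≤s (m≤n⊔m n (suc n))

Equiv-upper-unique : ∀ {Δ Γ n x u v} → Δ ∋ x ∶ n → Δ ∋ u ∶ suc n → Δ ∋ v ∶ suc n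
  → Δ ∣ Γ ⊢ C.Equiv n (suc n) x u → Δ ∣ Γ ⊢ C.Equiv n (suc n) x v → Δ ∣ Γ ⊢ C.eq u v
Equiv-upper-unique {Δ} {Γ} {n} {x} {u} {v} px pu pv du dv =
  Leibniz⇒eq pu pv ≤-refl
    (∀I-same (wf-⇔ wu wv) (⇔-trans wu wv (⇔-sym (through-x pu du)) (through-x pv dv)))
  where
    wu : C.WF (suc (suc n) ∷ Δ) (C.ap 0 (suc u))
    wu = C.ap here (there pu) ≤-refl
    wv : C.WF (suc (suc n) ∷ Δ) (C.ap 0 (suc v))
    wv = C.ap here (there pv) ≤-refl
    through-x : ∀ {w} → Δ ∋ w ∶ suc n → Δ ∣ Γ ⊢ C.Equiv n (suc n) x w
              → (suc (suc n) ∷ Δ) ∣ map (C.wk 0) Γ ⊢ C.ap 0 (suc x) C.⇔ C.ap 0 (suc w)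
    through-x pw dw = Leibniz-at here (ssn≤ n) (n<ssn n) ≤-refl (there px) (there pw) (wk-⊢ _ dw)

-- Compare x and y through the comprehension class {w : w ≡ x} one type up.
Equiv-lower-unique : ∀ {Δ Γ n x y u} → Δ ∋ x ∶ n → Δ ∋ y ∶ n → Δ ∋ u ∶ suc n
  → Δ ∣ Γ ⊢ C.Equiv n (suc n) x u → Δ ∣ Γ ⊢ C.Equiv n (suc n) y u → Δ ∣ Γ ⊢ C.eq x y
Equiv-lower-unique {Δ} {Γ} {n} {x} {y} {u} px py pu dx dy =
  ∃E-same (C.∀' (wf-⇔ (C.ap (there here) here ≤-refl) (wf-wk1 wφ)))
    (C.comp {φ = C.Equiv (suc n) n 0 (suc x)} wφ)
    (=-sym (there py) (Leibniz⇒eq (there py) (there px) (s≤s (m≤n⊔m (suc n) n))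
      (⇔→ (member (there py) (n≤1+n n))
        (⇔← (through-u (there py) (wkΓ (wk-⊢ _ dy)))
          (⇔→ (through-u (there px) (wkΓ (wk-⊢ _ dx)))
            (⇔← (member (there px) (n≤1+n n)) (Leibniz-refl (there px) n<T)))))))
  where
    wφ : C.WF (suc n ∷ Δ) (C.Equiv (suc n) n 0 (suc x))
    wφ = wf-Equiv here (there px)
    n<T : n < suc (suc n ⊔ n)
    n<T = s≤s (≤-trans (n≤1+n n) (m≤m⊔n (suc n) n))
    member : ∀ {Γ′ w p} → (suc (suc n) ∷ Δ) ∋ w ∶ p → p ≤ suc n
           → (suc (suc n) ∷ Δ) ∣ C.∀' (suc n) (C.ap 1 0 C.⇔ C.wk 1 (C.Equiv (suc n) n 0 (suc x))) ∷ Γ′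
             ⊢ C.ap 0 w C.⇔ C.Equiv (suc n) n w (suc x)
    member pw le = C.∀E le pw
      (wf-⇔ (C.ap here pw (s≤s le)) (wf-Leibniz pw (there px) (s≤s (≤-trans le (m≤m⊔n (suc n) n))) n<T)) hyp₀
    through-u : ∀ {Γ′ w} → (suc (suc n) ∷ Δ) ∋ w ∶ n
              → (suc (suc n) ∷ Δ) ∣ Γ′ ⊢ C.Equiv n (suc n) w (suc u)
              → (suc (suc n) ∷ Δ) ∣ Γ′ ⊢ C.ap 0 w C.⇔ C.ap 0 (suc u)
    through-u pw = Leibniz-at here (ssn≤ n) (n<ssn n) ≤-refl pw (there pu)

IsUp⇒Equiv : ∀ {Δ Γ n x u} → Δ ∋ x ∶ n → Δ ∋ u ∶ suc n
           → Δ ∣ Γ ⊢ IsUp n x u → Δ ∣ Γ ⊢ C.Equiv n (suc n) x u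
IsUp⇒Equiv px pu d = ⇔← (C.∀E ≤-refl pu (wf-⇔ (wf-Equiv px pu) (C.eq pu pu)) d) (C.refl= pu)

Equiv⇒IsUp : ∀ {Δ Γ n x u} → Δ ∋ x ∶ n → Δ ∋ u ∶ suc n
           → Δ ∣ Γ ⊢ C.Equiv n (suc n) x u → Δ ∣ Γ ⊢ IsUp n x u
Equiv⇒IsUp {n = n} {x} px pu d =
  ∀I-same (wf-⇔ (wf-Equiv (there px) here) (C.eq here (there pu)))
    (⇔I (wf-Equiv (there px) here) (C.eq here (there pu))
      (Equiv-upper-unique (there px) here (there pu) hyp₀ (wkΓ (wk-⊢ _ d)))
      (C.subst= {φ = C.Equiv n (suc n) (suc (suc x)) 0} (wf-Equiv (there (there px)) here) (there pu)
        (=-sym here hyp₀) (wkΓ (wk-⊢ _ d))))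

IsUp-unique : ∀ {Δ Γ n x u v} → Δ ∋ x ∶ n → Δ ∋ u ∶ suc n → Δ ∋ v ∶ suc n
            → Δ ∣ Γ ⊢ IsUp n x u → Δ ∣ Γ ⊢ IsUp n x v → Δ ∣ Γ ⊢ C.eq v u
IsUp-unique px pu pv du dv = ⇔→ (C.∀E ≤-refl pv (wf-⇔ (wf-Equiv px pv) (C.eq pv pu)) du) (IsUp⇒Equiv px pv dv)

-- The witness is x itself, read at the next type.
IsUp-exists : ∀ {Δ Γ n x} → Δ ∋ x ∶ n → Δ ∣ Γ ⊢ C.∃' (suc n) (IsUp n (suc x) 0)
IsUp-exists {n = n} {x} px =
  ∃E-same (wf-Equiv (there px) here)
    (C.∃I {φ = C.Equiv n (suc n) (suc x) 0} (n≤1+n n) px (C.∃' (wf-Equiv (there px) here))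
      (Leibniz-refl px (s≤s (m≤m⊔n n (suc n)))))
    (C.∃I {φ = IsUp n (suc (suc x)) 0} ≤-refl here (C.∃' (wf-IsUp (there (there px)) here))
      (Equiv⇒IsUp (there px) here hyp₀))

Elem-intro : ∀ {Δ Γ a b w m n p} → Δ ∋ a ∶ m → Δ ∋ b ∶ n → Δ ∋ w ∶ p → p ≤ suc (m ⊔ n)
           → Δ ∣ Γ ⊢ C.Equiv (suc (m ⊔ n)) n w b → Δ ∣ Γ ⊢ C.ap w a → Δ ∣ Γ ⊢ C.Elem m n a b
Elem-intro pa pb pw le e d = C.∃I le pw (wf-Elem pa pb) (C.∧I e d)

type-founded : ∀ {Δ Γ a b m n} → Δ ∋ a ∶ m → Δ ∋ b ∶ suc n
             → Δ ∣ Γ ⊢ C.Elem m (suc n) a b → Δ ∣ Γ ⊢ C.∃' n (C.Equiv m n (suc a) 0)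
type-founded {m = m} {n} pa pb =
  C.⇒E (C.∀E ≤-refl pb (wf-Elem pa pb C.⇒ C.∃' (wf-Equiv (there pa) here))
         (C.∀E ≤-refl pa (C.∀' (wf-Elem (there pa) here C.⇒ C.∃' (wf-Equiv (there (there pa)) here)))
           (C.typeFounded m n)))

type-base : ∀ {Δ Γ a b m} → Δ ∋ a ∶ m → Δ ∋ b ∶ 0 → Δ ∣ Γ ⊢ C.Elem m 0 a b → Δ ∣ Γ ⊢ C.⊥'
type-base {m = m} pa pb =
  C.⇒E (C.∀E ≤-refl pa (wf-Elem pa pb C.⇒ C.⊥')
         (C.∀E ≤-refl pb (C.∀' (wf-Elem here (there pb) C.⇒ C.⊥')) (C.typeBase m)))

wf-desc : ∀ {Δ n x ψ} → Δ ∋ x ∶ n → C.WF (suc n ∷ Δ) ψ → C.WF Δ (desc n x ψ)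
wf-desc px w = C.∃' (wf-IsUp (there px) here C.∧ w)

desc-intro : ∀ {Δ Γ n x u ψ} → Δ ∋ x ∶ n → Δ ∋ u ∶ suc n → C.WF (suc n ∷ Δ) ψ
           → Δ ∣ Γ ⊢ IsUp n x u → Δ ∣ Γ ⊢ ψ C.[ u ] → Δ ∣ Γ ⊢ desc n x ψ
desc-intro {n = n} {x} {ψ = ψ} px pu w du dψ =
  C.∃I {φ = IsUp n (suc x) 0 C.∧ ψ} ≤-refl pu (wf-desc px w) (C.∧I du dψ)

desc-elim : ∀ {Δ Γ n x u ψ} → Δ ∋ x ∶ n → Δ ∋ u ∶ suc n → C.WF (suc n ∷ Δ) ψ
          → Δ ∣ Γ ⊢ desc n x ψ → Δ ∣ Γ ⊢ IsUp n x u → Δ ∣ Γ ⊢ ψ C.[ u ]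
desc-elim {n = n} {x} {u} {ψ} px pu w d du =
  C.∃E ≤-refl (wf-IsUp (there px) here C.∧ w) d
    (⊢-≡ (wk1-[suc] ψ u)
      (C.subst= {φ = C.wk 1 ψ} (wf-wk1 w) here
         (IsUp-unique (there px) (there pu) here (wkΓ (wk-⊢ _ du)) (C.∧E₁ hyp₀))
         (⊢-≡ (sym (wk1-[0] ψ)) (C.∧E₂ hyp₀))))

desc-⇔ : ∀ {Δ Γ n x u ψ} → Δ ∋ x ∶ n → Δ ∋ u ∶ suc n → C.WF (suc n ∷ Δ) ψ
       → Δ ∣ Γ ⊢ IsUp n x u → Δ ∣ Γ ⊢ desc n x ψ C.⇔ ψ C.[ u ]
desc-⇔ px pu w du =
  ⇔I (wf-desc px w) (wf-sub0 pu w) (desc-elim px pu w hyp₀ (wkΓ du)) (desc-intro px pu w (wkΓ du) hyp₀)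

desc-mono : ∀ {Δ Γ n x ψ1 ψ2} → Δ ∋ x ∶ n → C.WF (suc n ∷ Δ) ψ1 → C.WF (suc n ∷ Δ) ψ2
          → Δ ∣ Γ ⊢ desc n x ψ1
          → (suc n ∷ Δ) ∣ (IsUp n (suc x) 0 C.∧ ψ1) ∷ map (C.wk 0) Γ ⊢ ψ2
          → Δ ∣ Γ ⊢ desc n x ψ2
desc-mono {Δ} {Γ} {n} {x} {ψ1} {ψ2} px wψ1 w2 d e =
  C.∃E {ψ = desc n x ψ2} ≤-refl (wf-IsUp (there px) here C.∧ wψ1) d
    (C.∃I {φ = IsUp n (suc (suc x)) 0 C.∧ C.wk 1 ψ2} ≤-refl here (wf-desc (there px) (wf-wk1 w2))
       (C.∧I (C.∧E₁ hyp₀) (⊢-≡ (sym (wk1-[0] ψ2)) e)))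

desc-merge : ∀ {Δ Γ n x ψ1 ψ2} → Δ ∋ x ∶ n → C.WF (suc n ∷ Δ) ψ1 → C.WF (suc n ∷ Δ) ψ2
           → Δ ∣ Γ ⊢ desc n x ψ1 → Δ ∣ Γ ⊢ desc n x ψ2 → Δ ∣ Γ ⊢ desc n x (ψ1 C.∧ ψ2)
desc-merge {ψ2 = ψ2} px w1 w2 d1 d2 =
  desc-mono px w1 (w1 C.∧ w2) d1
    (C.∧I (C.∧E₂ hyp₀)
          (⊢-≡ (wk1-[0] ψ2) (desc-elim (there px) here (wf-wk1 w2) (wkΓ (wk-⊢ _ d2)) (C.∧E₁ hyp₀))))

desc-cong : ∀ {Δ Γ n x ψ₁ ψ₂} → Δ ∋ x ∶ n → C.WF (suc n ∷ Δ) ψ₁ → C.WF (suc n ∷ Δ) ψ₂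
          → (suc n ∷ Δ) ∣ map (C.wk 0) Γ ⊢ ψ₁ C.⇔ ψ₂ → Δ ∣ Γ ⊢ desc n x ψ₁ C.⇔ desc n x ψ₂
desc-cong px w₁ w₂ d =
  ⇔I (wf-desc px w₁) (wf-desc px w₂)
    (desc-mono px w₁ w₂ hyp₀ (⇔→ (weakenΓ (λ p → there (there p)) d) (C.∧E₂ hyp₀)))
    (desc-mono px w₂ w₁ hyp₀ (⇔← (weakenΓ (λ p → there (there p)) d) (C.∧E₂ hyp₀)))

-- The context reached, and the variable denoting ↑^k x, after eliminating the
-- k descriptions of ↑^k x for a variable x of type n.
elimCtx : ℕ → ℕ → Ctx → Ctx
elimCtx n zero    Δ = Δ
elimCtx n (suc k) Δ = elimCtx (suc n) k (suc n ∷ Δ)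

elimVar : ℕ → ℕ → ℕ
elimVar x zero    = x
elimVar x (suc k) = 0

elimVar-0 : ∀ k → elimVar 0 k ≡ 0
elimVar-0 zero    = refl
elimVar-0 (suc k) = refl

∋-cast : ∀ {Δ i t t'} → t ≡ t' → Δ ∋ i ∶ t → Δ ∋ i ∶ t'
∋-cast refl p = p

∋-reindex : ∀ {Δ i i' t} → i ≡ i' → Δ ∋ i ∶ t → Δ ∋ i' ∶ t
∋-reindex refl p = p

elimCtx-var : ∀ {Δ i t} n k → Δ ∋ i ∶ t → elimCtx n k Δ ∋ i + k ∶ t
elimCtx-var {i = i} n zero p = ∋-reindex (sym (+-identityʳ i)) p
elimCtx-var {i = i} n (suc k) p = ∋-reindex (sym (+-suc i k)) (elimCtx-var (suc n) k (there p))

elimCtx-elimVar : ∀ {Δ x n} k → Δ ∋ x ∶ n → elimCtx n k Δ ∋ elimVar x k ∶ (n + k)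
elimCtx-elimVar {n = n} zero p = ∋-cast (sym (+-identityʳ n)) p
elimCtx-elimVar {n = n} (suc k) p = ∋-cast (sym (+-suc n k)) (∋-reindex (elimVar-0 k) (elimCtx-elimVar k here))

wf-elimUp : ∀ {Δ n x} k (K : ℕ → ℕ → C.Fm) → Δ ∋ x ∶ n
          → C.WF (elimCtx n k Δ) (K k (elimVar x k)) → C.WF Δ (elimUp n x k K)
wf-elimUp zero K px w = w
wf-elimUp {Δ} {n} (suc k) K px w =
  wf-desc px (wf-elimUp k (λ d y → K (suc d) y) here
    (subst (λ z → C.WF (elimCtx (suc n) k (suc n ∷ Δ)) (K (suc k) z)) (sym (elimVar-0 k)) w))

-- inst d y instantiates the bound variable of a body by y from under d binders.
inst : ℕ → ℕ → Ren
inst d y zero    = y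
inst d y (suc i) = i + d

-- IsUps a X k U says that U is ↑^k X, and AtUps a X k χ that χ holds of ↑^k X.
IsUps : ℕ → ℕ → ℕ → ℕ → C.Fm
IsUps a X k U = elimUp a X k (λ d y → C.eq y (U + d))

AtUps : ℕ → ℕ → ℕ → C.Fm → C.Fm
AtUps a X k χ = elimUp a X k (λ d y → ren (inst d y) χ)

tyren-inst : ∀ {Δ a X} k → Δ ∋ X ∶ a → TyRen (a + k ∷ Δ) (elimCtx a k Δ) (inst k (elimVar X k))
tyren-inst k pX here = elimCtx-elimVar k pX
tyren-inst {a = a} k pX (there p) = elimCtx-var a k p

wf-AtUps : ∀ {Δ a X χ} k → Δ ∋ X ∶ a → C.WF (a + k ∷ Δ) χ → C.WF Δ (AtUps a X k χ)
wf-AtUps {χ = χ} k pX w = wf-elimUp k (λ d y → ren (inst d y) χ) pX (wf-ren (tyren-inst k pX) w)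

wf-IsUps : ∀ {Δ a X U} k → Δ ∋ X ∶ a → Δ ∋ U ∶ (a + k) → C.WF Δ (IsUps a X k U)
wf-IsUps {a = a} {U = U} k pX pU =
  wf-elimUp k (λ d y → C.eq y (U + d)) pX (C.eq (elimCtx-elimVar k pX) (elimCtx-var a k pU))

inst0 : ∀ X χ → ren (inst 0 X) χ ≡ χ C.[ X ]
inst0 X χ = trans (ren-ext (λ { zero → refl ; (suc i) → +-identityʳ i }) χ) (sym (sub-ren 0 X χ))

IsUps-step : ∀ a k U → elimUp (suc a) 0 k (λ d y → C.eq y (U + suc d)) ≡ IsUps (suc a) 0 k (suc U)
IsUps-step a k U = elimUp-ext (suc a) 0 k (λ d y → cong (C.eq y) (+-suc U d))

AtUps-step : ∀ a k χ → elimUp (suc a) 0 k (λ d y → ren (inst (suc d) y) χ) ≡ AtUps (suc a) 0 k (C.wk 1 χ)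
AtUps-step a k χ = elimUp-ext (suc a) 0 k λ d y →
  sym (trans (cong (ren (inst d y)) (wk-ren 1 χ))
      (trans (ren-∘ _ _ χ) (ren-ext (λ { zero → refl ; (suc j) → sym (+-suc j d) }) χ)))

wf-ty : ∀ {Δ n n' φ} → n ≡ n' → C.WF (n ∷ Δ) φ → C.WF (n' ∷ Δ) φ
wf-ty refl w = w

AtUps⇒sub : ∀ k {Δ Γ a X U χ} → Δ ∋ X ∶ a → Δ ∋ U ∶ (a + k) → C.WF (a + k ∷ Δ) χ
    → Δ ∣ Γ ⊢ IsUps a X k U → Δ ∣ Γ ⊢ AtUps a X k χ → Δ ∣ Γ ⊢ χ C.[ U ]
AtUps⇒sub zero {a = a} {X} {U} {χ} pX pU w dC dT =
  C.subst= {φ = χ} w (∋-cast (sym (+-identityʳ a)) pX)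
    (⊢-≡ (cong (C.eq X) (+-identityʳ U)) dC) (⊢-≡ (inst0 X χ) dT)
AtUps⇒sub (suc k) {Δ} {Γ} {a} {X} {U} {χ} pX pU w dC dT =
  C.∃E ≤-refl (wf-IsUp (there pX) here C.∧ (wA C.∧ wB)) (desc-merge pX wA wB dC dT)
    (⊢-≡ (wk1-[suc] χ U) (AtUps⇒sub k here pU' wχ' (⊢-≡ (IsUps-step a k U) (C.∧E₁ (C.∧E₂ hyp₀)))
                                       (⊢-≡ (AtUps-step a k χ) (C.∧E₂ (C.∧E₂ hyp₀)))))
  where
    pU' : (suc a ∷ Δ) ∋ suc U ∶ (suc a + k)
    pU' = there (∋-cast (+-suc a k) pU)
    wχ' : C.WF (suc a + k ∷ suc a ∷ Δ) (C.wk 1 χ)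
    wχ' = wf-wk1 (wf-ty (+-suc a k) w)
    wA : C.WF (suc a ∷ Δ) (elimUp (suc a) 0 k (λ d y → C.eq y (U + suc d)))
    wA = wf-≡ (sym (IsUps-step a k U)) (wf-IsUps k here pU')
    wB : C.WF (suc a ∷ Δ) (elimUp (suc a) 0 k (λ d y → ren (inst (suc d) y) χ))
    wB = wf-≡ (sym (AtUps-step a k χ)) (wf-AtUps k here wχ')

sub⇒AtUps : ∀ k {Δ Γ a X U χ} → Δ ∋ X ∶ a → Δ ∋ U ∶ (a + k) → C.WF (a + k ∷ Δ) χ
    → Δ ∣ Γ ⊢ IsUps a X k U → Δ ∣ Γ ⊢ χ C.[ U ] → Δ ∣ Γ ⊢ AtUps a X k χ
sub⇒AtUps zero {a = a} {X} {U} {χ} pX pU w dC dR =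
  ⊢-≡ (sym (inst0 X χ))
    (C.subst= {φ = χ} w pU
      (=-sym (∋-cast (sym (+-identityʳ a)) pX) (⊢-≡ (cong (C.eq X) (+-identityʳ U)) dC)) dR)
sub⇒AtUps (suc k) {Δ} {Γ} {a} {X} {U} {χ} pX pU w dC dR =
  desc-mono pX wA wB dC
    (⊢-≡ (sym (AtUps-step a k χ))
      (sub⇒AtUps k here pU' wχ' (⊢-≡ (IsUps-step a k U) (C.∧E₂ hyp₀))
        (⊢-≡ (sym (wk1-[suc] χ U)) (wkΓ (wk-⊢ _ dR)))))
  where
    pU' : (suc a ∷ Δ) ∋ suc U ∶ (suc a + k)
    pU' = there (∋-cast (+-suc a k) pU)
    wχ' : C.WF (suc a + k ∷ suc a ∷ Δ) (C.wk 1 χ)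
    wχ' = wf-wk1 (wf-ty (+-suc a k) w)
    wA : C.WF (suc a ∷ Δ) (elimUp (suc a) 0 k (λ d y → C.eq y (U + suc d)))
    wA = wf-≡ (sym (IsUps-step a k U)) (wf-IsUps k here pU')
    wB : C.WF (suc a ∷ Δ) (elimUp (suc a) 0 k (λ d y → ren (inst (suc d) y) χ))
    wB = wf-≡ (sym (AtUps-step a k χ)) (wf-AtUps k here wχ')

IsUps-ren : ∀ ρ a X k U → ren ρ (IsUps a X k U) ≡ IsUps a (ρ X) k (ρ U)
IsUps-ren ρ a X k U = elimUp-ren ρ a X k _ _ (λ d y → cong (C.eq (liftN d ρ y)) (sym (liftN-+ d ρ U)))

IsUps-sub : ∀ a X k U b → (IsUps a X k U) C.[ b ] ≡ IsUps a (C.subv 0 b X) k (C.subv 0 b U)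
IsUps-sub a X k U b = trans (sub-ren 0 b _) (IsUps-ren _ a X k U)

IsUps-wk : ∀ c a X k U → C.wk c (IsUps a X k U) ≡ IsUps a (wkv c X) k (wkv c U)
IsUps-wk c a X k U = trans (wk-ren c _) (IsUps-ren _ a X k U)

IsUps-exists : ∀ k {Δ Γ a X} → Δ ∋ X ∶ a → Δ ∣ Γ ⊢ C.∃' (a + k) (IsUps a (suc X) k 0)
IsUps-exists zero {a = a} {X} pX =
  C.∃I {φ = IsUps a (suc X) 0 0} (≤-reflexive (sym (+-identityʳ a))) pX
       (C.∃' (C.eq (there (∋-cast (sym (+-identityʳ a)) pX)) here)) (C.refl= pX)
IsUps-exists (suc k) {Δ} {Γ} {a} {X} pX =
  C.∃E {m = suc a} {n = suc a} ≤-refl (wf-IsUp (there pX) here) (IsUp-exists pX)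
    (C.∃E {m = suc a + k} ≤-refl (wf-IsUps k (there here) here) (IsUps-exists k {X = 0} here)
      (⊢-≡ (sym goal≡)
        (C.∃I {φ = IsUps a (suc (suc (suc X))) (suc k) 0} (≤-reflexive (sym (+-suc a k))) here
           (C.∃' (wf-IsUps (suc k) (there (there (there pX))) here))
           (⊢-≡ (sym (IsUps-sub a (suc (suc (suc X))) (suc k) 0 0))
             (desc-intro {ψ = IsUps (suc a) 0 k 1} (there (there pX)) (there here)
                (wf-IsUps k here (there here))
                (hyp₁)
                (⊢-≡ (sym (IsUps-sub (suc a) 0 k 1 1)) hyp₀))))))
  where
    goal≡ : C.wk 0 (C.wk 0 (C.∃' (a + suc k) (IsUps a (suc X) (suc k) 0)))
          ≡ C.∃' (a + suc k) (IsUps a (suc (suc (suc X))) (suc k) 0)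
    goal≡ = cong (C.∃' (a + suc k)) (trans (cong (C.wk 1) (IsUps-wk 1 a (suc X) (suc k) 0))
                                          (IsUps-wk 1 a (suc (suc X)) (suc k) 0))

elimUp-+ : ∀ a X k j K
         → elimUp a X (k + j) K ≡ elimUp a X k (λ d y → elimUp (a + k) y j (λ d′ z → K (d + d′) z))
elimUp-+ a X zero j K = cong (λ b → elimUp b X j K) (sym (+-identityʳ a))
elimUp-+ a X (suc k) j K =
  cong (desc a X) (trans (elimUp-+ (suc a) 0 k j (λ d y → K (suc d) y))
    (elimUp-ext (suc a) 0 k (λ d y → cong (λ b → elimUp b y j (λ d′ z → K (suc d + d′) z)) (sym (+-suc a k)))))

shiftR : ℕ → Ren
shiftR j i = i + j

elimUp-cong : ∀ j {Δ Γ A I} (K₁ K₂ : ℕ → ℕ → C.Fm) (H : C.Fm) → Δ ∋ I ∶ A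
  → C.WF (elimCtx A j Δ) (K₁ j (elimVar I j)) → C.WF (elimCtx A j Δ) (K₂ j (elimVar I j))
  → (∀ {Γ′} → elimCtx A j Δ ∣ Γ′ ⊢ ren (shiftR j) H
             → elimCtx A j Δ ∣ Γ′ ⊢ K₁ j (elimVar I j) C.⇔ K₂ j (elimVar I j))
  → Δ ∣ Γ ⊢ H → Δ ∣ Γ ⊢ elimUp A I j K₁ C.⇔ elimUp A I j K₂
elimUp-cong zero K₁ K₂ H pI w₁ w₂ P dH = P (⊢-≡ (sym (ren-id +-identityʳ H)) dH)
elimUp-cong (suc j) {Δ} {Γ} {A} {I} K₁ K₂ H pI w₁ w₂ P dH =
  desc-cong pI (wf-elimUp j K₁′ here w₁′) (wf-elimUp j K₂′ here w₂′)
    (elimUp-cong j K₁′ K₂′ (C.wk 0 H) here w₁′ w₂′ P′ (wk-⊢ (suc A) dH))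
  where
    K₁′ K₂′ : ℕ → ℕ → C.Fm
    K₁′ d y = K₁ (suc d) y
    K₂′ d y = K₂ (suc d) y
    Δ′ = elimCtx (suc A) j (suc A ∷ Δ)
    w₁′ : C.WF Δ′ (K₁ (suc j) (elimVar 0 j))
    w₁′ = subst (λ z → C.WF Δ′ (K₁ (suc j) z)) (sym (elimVar-0 j)) w₁
    w₂′ : C.WF Δ′ (K₂ (suc j) (elimVar 0 j))
    w₂′ = subst (λ z → C.WF Δ′ (K₂ (suc j) z)) (sym (elimVar-0 j)) w₂
    shift-wk : ren (shiftR j) (C.wk 0 H) ≡ ren (shiftR (suc j)) H
    shift-wk = trans (cong (ren (shiftR j)) (wk-ren 0 H)) (ren-fuse _ _ _ H (λ i → sym (+-suc i j)))
    P′ : ∀ {Γ′} → Δ′ ∣ Γ′ ⊢ ren (shiftR j) (C.wk 0 H) → Δ′ ∣ Γ′ ⊢ K₁ (suc j) (elimVar 0 j) C.⇔ K₂ (suc j) (elimVar 0 j)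
    P′ {Γ′} h = subst (λ z → Δ′ ∣ Γ′ ⊢ K₁ (suc j) z C.⇔ K₂ (suc j) z) (sym (elimVar-0 j)) (P (⊢-≡ shift-wk h))

RelWF : (ℕ → ℕ → C.Fm) → ℕ → ℕ → Set
RelWF R T1 T2 = ∀ {Δ' p q} → Δ' ∋ p ∶ T1 → Δ' ∋ q ∶ T2 → C.WF Δ' (R p q)

wf-elimAtom : ∀ {Δ A I B W} R j1 j2 → Δ ∋ I ∶ A → Δ ∋ W ∶ B → RelWF R (A + j1) (B + j2)
         → C.WF Δ (elimAtom R A I j1 B W j2)
wf-elimAtom {A = A} {I} {B} {W} R j1 j2 pI pW RW =
  wf-elimUp j1 _ pI (wf-elimUp j2 _ (elimCtx-var A j1 pW)
    (RW (elimCtx-var B j2 (elimCtx-elimVar j1 pI)) (elimCtx-elimVar j2 (elimCtx-var A j1 pW))))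

+-rearrange : ∀ a j k n → a + k ≡ n → a + (j + k) ≡ n + j
+-rearrange a j k n e = begin
  a + (j + k) ≡⟨ sym (+-assoc a j k) ⟩
  a + j + k   ≡⟨ cong (_+ k) (+-comm a j) ⟩
  j + a + k   ≡⟨ +-assoc j a k ⟩
  j + (a + k) ≡⟨ cong (j +_) e ⟩
  j + n       ≡⟨ +-comm j n ⟩
  n + j       ∎
  where open ≡-Reasoning

-- If U is ↑^k X, the argument ↑^(j1+k) X of an atom may be replaced by ↑^j1 U.
atom-left-⇔ : ∀ {Δ Γ a X k n U B W} (R : ℕ → ℕ → C.Fm) → RelRen R → ∀ j1 j2
  → a + k ≡ n → Δ ∋ X ∶ a → Δ ∋ U ∶ n → Δ ∋ W ∶ B
  → RelWF R (n + j1) (B + j2)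
  → Δ ∣ Γ ⊢ IsUps a X k U
  → Δ ∣ Γ ⊢ elimAtom R a X (j1 + k) B W j2 C.⇔ elimAtom R n U j1 B W j2
atom-left-⇔ {Δ} {Γ} {a} {X} {k} {n} {U} {B} {W} R Rr j1 j2 e pX pU pW RW dH =
  ⇔I wL wR
     (⊢-≡ eqR (AtUps⇒sub k pX pU' wχ' (wkΓ dH) (⊢-≡ eqL hyp₀)))
     (⊢-≡ (sym eqL) (sub⇒AtUps k pX pU' wχ' (wkΓ dH) (⊢-≡ (sym eqR) hyp₀)))
  where
    χ = elimAtom R n 0 j1 B (suc W) j2
    pU' : Δ ∋ U ∶ (a + k)
    pU' = ∋-cast (sym e) pU
    wχ : C.WF (n ∷ Δ) χ
    wχ = wf-elimAtom R j1 j2 here (there pW) RW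
    wχ' : C.WF (a + k ∷ Δ) χ
    wχ' = wf-ty (sym e) wχ
    wR : C.WF Δ (elimAtom R n U j1 B W j2)
    wR = wf-elimAtom R j1 j2 pU pW RW
    eqR : χ C.[ U ] ≡ elimAtom R n U j1 B W j2
    eqR = trans (sub-ren 0 U χ) (elimAtom-ren (C.subv 0 U) R Rr n 0 j1 B (suc W) j2)
    eqL : elimAtom R a X (j1 + k) B W j2 ≡ AtUps a X k χ
    K : ℕ → ℕ → C.Fm
    K d y = elimUp B (W + d) j2 (λ d′ z → R (y + d′) z)
    eqL = trans (cong (λ m → elimUp a X m K) (+-comm j1 k))
          (trans (elimUp-+ a X k j1 K)
           (elimUp-ext a X k λ d y →
             trans (cong (λ b → elimUp b y j1 _) e)
              (trans (elimUp-ext n y j1 (λ d′ z →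
                        cong (λ v → elimUp B v j2 (λ d″ w → R (z + d″) w)) (sym (+-assoc W d d′))))
               (sym (elimAtom-ren (inst d y) R Rr n 0 j1 B (suc W) j2)))))
    wL : C.WF Δ (elimAtom R a X (j1 + k) B W j2)
    wL = wf-≡ (sym eqL) (wf-AtUps k pX wχ')

flipRel : (ℕ → ℕ → C.Fm) → ℕ → ℕ → C.Fm
flipRel R p q = R q p

elimUp-flip : ∀ R a X m B' Y → elimUp a X m (λ d′ z → R (Y + d′) z) ≡ elimAtom (flipRel R) a X m B' Y 0
elimUp-flip R a X m B' Y = elimUp-ext a X m (λ d z → cong (R (Y + d)) (sym (+-identityʳ z)))

-- Under the j1 descriptions of the left argument, the right argument is handled
-- by atom-left-⇔ for the flipped relation.
atom-right-⇔ : ∀ {Δ Γ a X k n U A I} (R : ℕ → ℕ → C.Fm) → RelRen R → ∀ j1 j2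
  → a + k ≡ n → Δ ∋ X ∶ a → Δ ∋ U ∶ n → Δ ∋ I ∶ A
  → RelWF R (A + j1) (n + j2)
  → Δ ∣ Γ ⊢ IsUps a X k U
  → Δ ∣ Γ ⊢ elimAtom R A I j1 a X (j2 + k) C.⇔ elimAtom R A I j1 n U j2
atom-right-⇔ {Δ} {Γ} {a} {X} {k} {n} {U} {A} {I} R Rr j1 j2 e pX pU pI RW dH =
  elimUp-cong j1 K₁ K₂ (IsUps a X k U) pI
    (wf-≡ (sym flip₁) wL) (wf-≡ (sym flip₂) wR)
    (λ h → ⊢-≡ (cong₂ C._⇔_ (sym flip₁) (sym flip₂))
              (atom-left-⇔ (flipRel R) (λ σ p q → Rr σ q p) j2 0 e
                 (elimCtx-var A j1 pX) (elimCtx-var A j1 pU) pY RW'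
                 (⊢-≡ (IsUps-ren (shiftR j1) a X k U) h)))
    dH
  where
    K₁ K₂ : ℕ → ℕ → C.Fm
    K₁ d y = elimUp a (X + d) (j2 + k) (λ d′ z → R (y + d′) z)
    K₂ d y = elimUp n (U + d) j2 (λ d′ z → R (y + d′) z)
    Y = elimVar I j1
    pY : elimCtx A j1 Δ ∋ Y ∶ (A + j1)
    pY = elimCtx-elimVar j1 pI
    RW' : RelWF (flipRel R) (n + j2) (A + j1 + 0)
    RW' p q = RW (∋-cast (+-identityʳ _) q) p
    wL : C.WF (elimCtx A j1 Δ) (elimAtom (flipRel R) a (X + j1) (j2 + k) (A + j1) Y 0)
    wL = wf-elimAtom (flipRel R) (j2 + k) 0 (elimCtx-var A j1 pX) pY
           (λ p q → RW (∋-cast (+-identityʳ _) q) (∋-cast (+-rearrange a j2 k n e) p))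
    wR : C.WF (elimCtx A j1 Δ) (elimAtom (flipRel R) n (U + j1) j2 (A + j1) Y 0)
    wR = wf-elimAtom (flipRel R) j2 0 (elimCtx-var A j1 pU) pY RW'
    flip₁ : K₁ j1 Y ≡ elimAtom (flipRel R) a (X + j1) (j2 + k) (A + j1) Y 0
    flip₁ = elimUp-flip R a (X + j1) (j2 + k) (A + j1) Y
    flip₂ : K₂ j1 Y ≡ elimAtom (flipRel R) n (U + j1) j2 (A + j1) Y 0
    flip₂ = elimUp-flip R n (U + j1) j2 (A + j1) Y

atom-both-⇔ : ∀ {Δ Γ a X k n U} (R : ℕ → ℕ → C.Fm) → RelRen R → ∀ j1 j2
  → a + k ≡ n → Δ ∋ X ∶ a → Δ ∋ U ∶ n
  → RelWF R (n + j1) (n + j2)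
  → Δ ∣ Γ ⊢ IsUps a X k U
  → Δ ∣ Γ ⊢ elimAtom R a X (j1 + k) a X (j2 + k) C.⇔ elimAtom R n U j1 n U j2
atom-both-⇔ {Δ} {Γ} {a} {X} {k} {n} {U} R Rr j1 j2 e pX pU RW dH =
  ⇔-trans (wf-elimAtom R (j1 + k) (j2 + k) pX pX RW1) (wf-elimAtom R j1 j2 pU pU RW)
    (atom-left-⇔ R Rr j1 (j2 + k) e pX pU pX RW2 dH)
    (atom-right-⇔ R Rr j1 j2 e pX pU pU RW dH)
  where
    RW1 : RelWF R (a + (j1 + k)) (a + (j2 + k))
    RW1 p q = RW (∋-cast (+-rearrange a j1 k n e) p) (∋-cast (+-rearrange a j2 k n e) q)
    RW2 : RelWF R (n + j1) (a + (j2 + k))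
    RW2 p q = RW p (∋-cast (+-rearrange a j2 k n e) q)

-- Substitution in STT^↑

ups : ℕ → S.Tm → S.Tm
ups zero    t = t
ups (suc k) t = S.up (ups k t)

renT-∘ : ∀ ρ σ t → renT ρ (renT σ t) ≡ renT (ρ ∘ σ) t
renT-∘ ρ σ (S.var i) = refl
renT-∘ ρ σ (S.up t) = cong S.up (renT-∘ ρ σ t)

renS-∘ : ∀ ρ σ φ → renS ρ (renS σ φ) ≡ renS (ρ ∘ σ) φ
renS-∘ ρ σ (S.ap t s) = cong₂ S.ap (renT-∘ ρ σ t) (renT-∘ ρ σ s)
renS-∘ ρ σ (S.eq t s) = cong₂ S.eq (renT-∘ ρ σ t) (renT-∘ ρ σ s)
renS-∘ ρ σ S.⊥' = refl
renS-∘ ρ σ (φ S.⇒ ψ) = cong₂ S._⇒_ (renS-∘ ρ σ φ) (renS-∘ ρ σ ψ)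
renS-∘ ρ σ (φ S.∧ ψ) = cong₂ S._∧_ (renS-∘ ρ σ φ) (renS-∘ ρ σ ψ)
renS-∘ ρ σ (φ S.∨ ψ) = cong₂ S._∨_ (renS-∘ ρ σ φ) (renS-∘ ρ σ ψ)
renS-∘ ρ σ (S.∀' n φ) = cong (S.∀' n) (trans (renS-∘ (lift ρ) (lift σ) φ) (renS-ext (lift-∘ ρ σ) φ))
renS-∘ ρ σ (S.∃' n φ) = cong (S.∃' n) (trans (renS-∘ (lift ρ) (lift σ) φ) (renS-ext (lift-∘ ρ σ) φ))

renT-id : ∀ {ρ} → ρ ≗ id → ∀ t → renT ρ t ≡ t
renT-id e (S.var i) = cong S.var (e i)
renT-id e (S.up t) = cong S.up (renT-id e t)

renS-id : ∀ {ρ} → ρ ≗ id → ∀ φ → renS ρ φ ≡ φ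
renS-id e (S.ap t s) = cong₂ S.ap (renT-id e t) (renT-id e s)
renS-id e (S.eq t s) = cong₂ S.eq (renT-id e t) (renT-id e s)
renS-id e S.⊥' = refl
renS-id e (φ S.⇒ ψ) = cong₂ S._⇒_ (renS-id e φ) (renS-id e ψ)
renS-id e (φ S.∧ ψ) = cong₂ S._∧_ (renS-id e φ) (renS-id e ψ)
renS-id e (φ S.∨ ψ) = cong₂ S._∨_ (renS-id e φ) (renS-id e ψ)
renS-id e (S.∀' n φ) = cong (S.∀' n) (renS-id (λ { zero → refl ; (suc i) → cong suc (e i) }) φ)
renS-id e (S.∃' n φ) = cong (S.∃' n) (renS-id (λ { zero → refl ; (suc i) → cong suc (e i) }) φ)

sub-var0-wk1 : ∀ φ → S.sub 0 (S.var 0) (S.wk 1 φ) ≡ φ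
sub-var0-wk1 φ = trans (subSv-ren 0 0 _) (trans (cong (renS (C.subv 0 0)) (wkS-ren 1 φ))
         (trans (renS-∘ _ _ φ) (renS-id (λ { zero → refl ; (suc i) → refl }) φ)))

chain-eta : ∀ t → t ≡ ups (proj₁ (chain t)) (S.var (proj₂ (chain t)))
chain-eta (S.var i) = refl
chain-eta (S.up t) = cong S.up (chain-eta t)

wkT-ups : ∀ c k x → S.wkT c (ups k (S.var x)) ≡ ups k (S.var (wkv c x))
wkT-ups c zero x = refl
wkT-ups c (suc k) x = cong S.up (wkT-ups c k x)

plusT0 : ∀ t → S.plusT 0 t ≡ t
plusT0 (S.var i) = refl
plusT0 (S.up t) = cong S.up (plusT0 t)

plusT-suc : ∀ c t → S.plusT (suc c) t ≡ S.wkT 0 (S.plusT c t)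
plusT-suc c (S.var i) = refl
plusT-suc c (S.up t) = cong S.up (plusT-suc c t)

wkT-wkT : ∀ c t → S.wkT 0 (S.wkT c t) ≡ S.wkT (suc c) (S.wkT 0 t)
wkT-wkT c (S.var i) = refl
wkT-wkT c (S.up t) = cong S.up (wkT-wkT c t)

maybe-suc : ∀ c s h → maybe S.var (S.plusT (suc c) s) (Maybe.map suc h) ≡ S.wkT 0 (maybe S.var (S.plusT c s) h)
maybe-suc c s nothing = plusT-suc c s
maybe-suc c s (just x) = refl

subT-wkT-suc-var : ∀ c t i → S.subT c (S.wkT 0 t) (S.var (wkv (suc c) i)) ≡ S.wkT c (S.subT c t (S.var i))
subT-wkT-suc-var zero t zero = trans (plusT0 _) (cong (S.wkT 0) (sym (plusT0 t)))
subT-wkT-suc-var zero t (suc i) = refl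
subT-wkT-suc-var (suc c) t zero = refl
subT-wkT-suc-var (suc c) t (suc i) =
  trans (maybe-suc c (S.wkT 0 t) (hitv c (wkv (suc c) i)))
  (trans (cong (S.wkT 0) (subT-wkT-suc-var c t i))
  (trans (wkT-wkT c _) (cong (S.wkT (suc c)) (sym (maybe-suc c t (hitv c i))))))

subT-wkT-suc : ∀ c t s → S.subT c (S.wkT 0 t) (S.wkT (suc c) s) ≡ S.wkT c (S.subT c t s)
subT-wkT-suc c t (S.var i) = subT-wkT-suc-var c t i
subT-wkT-suc c t (S.up s) = cong S.up (subT-wkT-suc c t s)

sub-wk-suc : ∀ c t φ → S.sub c (S.wkT 0 t) (S.wk (suc c) φ) ≡ S.wk c (S.sub c t φ)
sub-wk-suc c t (S.ap a b) = cong₂ S.ap (subT-wkT-suc c t a) (subT-wkT-suc c t b)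
sub-wk-suc c t (S.eq a b) = cong₂ S.eq (subT-wkT-suc c t a) (subT-wkT-suc c t b)
sub-wk-suc c t S.⊥' = refl
sub-wk-suc c t (φ S.⇒ ψ) = cong₂ S._⇒_ (sub-wk-suc c t φ) (sub-wk-suc c t ψ)
sub-wk-suc c t (φ S.∧ ψ) = cong₂ S._∧_ (sub-wk-suc c t φ) (sub-wk-suc c t ψ)
sub-wk-suc c t (φ S.∨ ψ) = cong₂ S._∨_ (sub-wk-suc c t φ) (sub-wk-suc c t ψ)
sub-wk-suc c t (S.∀' n φ) = cong (S.∀' n) (sub-wk-suc (suc c) t φ)
sub-wk-suc c t (S.∃' n φ) = cong (S.∃' n) (sub-wk-suc (suc c) t φ)

subT-wkT : ∀ s t → S.subT 0 s (S.wkT 0 t) ≡ t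
subT-wkT s (S.var i) = refl
subT-wkT s (S.up t) = cong S.up (subT-wkT s t)

renT-ty : ∀ {Δ Δ' ρ t n} → TyRen Δ Δ' ρ → Δ S.⊢t t ∶ n → Δ' S.⊢t renT ρ t ∶ n
renT-ty f (S.var p) = S.var (f p)
renT-ty f (S.up d) = S.up (renT-ty f d)

wfS-ren : ∀ {Δ Δ' ρ φ} → TyRen Δ Δ' ρ → S.WF Δ φ → S.WF Δ' (renS ρ φ)
wfS-ren f (S.ap a b) = S.ap (renT-ty f a) (renT-ty f b)
wfS-ren f (S.eq a b) = S.eq (renT-ty f a) (renT-ty f b)
wfS-ren f S.⊥' = S.⊥'
wfS-ren f (w S.⇒ w₁) = wfS-ren f w S.⇒ wfS-ren f w₁
wfS-ren f (w S.∧ w₁) = wfS-ren f w S.∧ wfS-ren f w₁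
wfS-ren f (w S.∨ w₁) = wfS-ren f w S.∨ wfS-ren f w₁
wfS-ren f (S.∀' w) = S.∀' (wfS-ren (tyren-lift _ f) w)
wfS-ren f (S.∃' w) = S.∃' (wfS-ren (tyren-lift _ f) w)

wfS-≡ : ∀ {Δ φ ψ} → φ ≡ ψ → S.WF Δ φ → S.WF Δ ψ
wfS-≡ refl w = w

wfS-wk0 : ∀ {Δ n φ} → S.WF Δ φ → S.WF (n ∷ Δ) (S.wk 0 φ)
wfS-wk0 {φ = φ} w = wfS-≡ (sym (wkS-ren 0 φ)) (wfS-ren there w)

wfS-wk1 : ∀ {Δ n m φ} → S.WF (n ∷ Δ) φ → S.WF (n ∷ m ∷ Δ) (S.wk 1 φ)
wfS-wk1 {φ = φ} w = wfS-≡ (sym (wkS-ren 1 φ)) (wfS-ren tyren-wk1 w)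

TyRefl : Ctx → Ctx → Ren → Set
TyRefl Δ Δ' ρ = ∀ {i m} → Δ' ∋ ρ i ∶ m → Δ ∋ i ∶ m

tyrefl-lift : ∀ {Δ Δ' ρ} k → TyRefl Δ Δ' ρ → TyRefl (k ∷ Δ) (k ∷ Δ') (lift ρ)
tyrefl-lift k f {zero} here = here
tyrefl-lift k f {suc i} (there p) = there (f p)

renT-inv : ∀ {Δ Δ' ρ m} t → TyRefl Δ Δ' ρ → Δ' S.⊢t renT ρ t ∶ m → Δ S.⊢t t ∶ m
renT-inv (S.var i) f (S.var p) = S.var (f p)
renT-inv (S.up t) f (S.up d) = S.up (renT-inv t f d)

wfS-inv : ∀ {Δ Δ' ρ} φ → TyRefl Δ Δ' ρ → S.WF Δ' (renS ρ φ) → S.WF Δ φ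
wfS-inv (S.ap t s) f (S.ap a b) = S.ap (renT-inv t f a) (renT-inv s f b)
wfS-inv (S.eq t s) f (S.eq a b) = S.eq (renT-inv t f a) (renT-inv s f b)
wfS-inv S.⊥' f w = S.⊥'
wfS-inv (φ S.⇒ ψ) f (w S.⇒ w₁) = wfS-inv φ f w S.⇒ wfS-inv ψ f w₁
wfS-inv (φ S.∧ ψ) f (w S.∧ w₁) = wfS-inv φ f w S.∧ wfS-inv ψ f w₁
wfS-inv (φ S.∨ ψ) f (w S.∨ w₁) = wfS-inv φ f w S.∨ wfS-inv ψ f w₁
wfS-inv (S.∀' n φ) f (S.∀' w) = S.∀' (wfS-inv φ (tyrefl-lift n f) w)
wfS-inv (S.∃' n φ) f (S.∃' w) = S.∃' (wfS-inv φ (tyrefl-lift n f) w)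

wfS-str0 : ∀ {Δ n} φ → S.WF (n ∷ Δ) (S.wk 0 φ) → S.WF Δ φ
wfS-str0 φ w = wfS-inv φ (λ { (there p) → p }) (wfS-≡ (wkS-ren 0 φ) w)

wf-⇔ₛ : ∀ {Δ φ ψ} → S.WF Δ φ → S.WF Δ ψ → S.WF Δ (φ S.⇔ ψ)
wf-⇔ₛ a b = (a S.⇒ b) S.∧ (b S.⇒ a)

wf-IdScheme : ∀ {Δ n} → S.WF Δ (S.IdScheme n)
wf-IdScheme = S.∀' (S.∀' (wf-⇔ₛ (S.eq (S.var (there here)) (S.var here))
  (S.∀' (wf-⇔ₛ (S.ap (S.var here) (S.var (there (there here)))) (S.ap (S.var here) (S.var (there here)))))))

wf-UpInject : ∀ {Δ n} → S.WF Δ (S.UpInject n)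
wf-UpInject = S.∀' (S.∀' (S.eq (S.up (S.var (there here))) (S.up (S.var here))
                          S.⇒ S.eq (S.var (there here)) (S.var here)))

wf-UpPossess : ∀ {Δ n} → S.WF Δ (S.UpPossess n)
wf-UpPossess = S.∀' (S.∀' (wf-⇔ₛ (S.ap (S.up (S.var here)) (S.up (S.var (there here))))
                                  (S.ap (S.var here) (S.var (there here)))))

wf-UpFounded : ∀ {Δ n} → S.WF Δ (S.UpFounded n)
wf-UpFounded = S.∀' (S.∀' (S.ap (S.up (S.var here)) (S.var (there here))
                           S.⇒ S.∃' (S.eq (S.var (there (there here))) (S.up (S.var here)))))

wf-UpBase : ∀ {Δ} → S.WF Δ S.UpBase
wf-UpBase = S.∀' (S.∀' (S.ap (S.up (S.var here)) (S.var (there here)) S.⇒ S.⊥'))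

∋-uniq : ∀ {Δ i a b} → Δ ∋ i ∶ a → Δ ∋ i ∶ b → a ≡ b
∋-uniq here here = refl
∋-uniq (there p) (there q) = ∋-uniq p q

⊢t-uniq : ∀ {Δ t a b} → Δ S.⊢t t ∶ a → Δ S.⊢t t ∶ b → a ≡ b
⊢t-uniq (S.var p) (S.var q) = ∋-uniq p q
⊢t-uniq (S.up d) (S.up e) = cong suc (⊢t-uniq d e)

∋→ty : ∀ {Δ i a} → Δ ∋ i ∶ a → ty Δ i ≡ a
∋→ty here = refl
∋→ty (there p) = ∋→ty p

record ChainTyping (Δ : Ctx) (t : S.Tm) (T : ℕ) : Set where
  constructor mkChainTyping
  field
    baseType  : ℕ
    base-typed : Δ ∋ proj₂ (chain t) ∶ baseType
    height-adds-up  : baseType + proj₁ (chain t) ≡ T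

chainTyping : ∀ {Δ t T} → Δ S.⊢t t ∶ T → ChainTyping Δ t T
chainTyping (S.var {n = n} p) = mkChainTyping n p (+-identityʳ n)
chainTyping (S.up d) with chainTyping d
... | mkChainTyping a p e = mkChainTyping a p (trans (+-suc a _) (cong suc e))

wf-atomJ : ∀ {Δ t s} R (T1 T2 : ℕ) → Δ S.⊢t t ∶ T1 → Δ S.⊢t s ∶ T2
         → RelWF R T1 T2 → C.WF Δ (atomJ Δ R t s)
wf-atomJ {Δ} {t} {s} R T1 T2 dt ds RW with chainTyping dt | chainTyping ds
... | mkChainTyping a p e | mkChainTyping b q e' rewrite ∋→ty p | ∋→ty q =
  wf-elimAtom R (proj₁ (chain t)) (proj₁ (chain s)) p q (λ p' q' → RW (∋-cast e p') (∋-cast e' q'))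

J-wf : ∀ {Δ φ} → S.WF Δ φ → C.WF Δ (J Δ φ)
J-wf {φ = S.ap t s} (S.ap {n = n} dt ds) = wf-atomJ C.ap (suc n) n dt ds (λ p q → C.ap p q ≤-refl)
J-wf {φ = S.eq t s} (S.eq {n = n} dt ds) = wf-atomJ C.eq n n dt ds (λ p q → C.eq p q)
J-wf S.⊥' = C.⊥'
J-wf (w S.⇒ w₁) = J-wf w C.⇒ J-wf w₁
J-wf (w S.∧ w₁) = J-wf w C.∧ J-wf w₁
J-wf (w S.∨ w₁) = J-wf w C.∨ J-wf w₁
J-wf (S.∀' w) = C.∀' (J-wf w)
J-wf (S.∃' w) = C.∃' (J-wf w)

data VarView (Δ₀ : Ctx) (n : ℕ) (Δ : Ctx) (i a : ℕ) : Set where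
  vhit  : hitv (length Δ₀) i ≡ nothing → a ≡ n → VarView Δ₀ n Δ i a
  vmiss : ∀ i' → hitv (length Δ₀) i ≡ just i' → (Δ₀ ++ Δ) ∋ i' ∶ a → VarView Δ₀ n Δ i a

varView : ∀ Δ₀ {n Δ i a} → (Δ₀ ++ n ∷ Δ) ∋ i ∶ a → VarView Δ₀ n Δ i a
varView [] here = vhit refl refl
varView [] (there p) = vmiss _ refl p
varView (m ∷ Δ₀) here = vmiss 0 refl here
varView (m ∷ Δ₀) {i = suc i} (there p) with varView Δ₀ p
... | vhit e1 e2 = vhit (cong (Maybe.map suc) e1) e2
... | vmiss i' e p' = vmiss (suc i') (cong (Maybe.map suc) e) (there p')

++var : ∀ Δ₀ {Δ x a} → Δ ∋ x ∶ a → (Δ₀ ++ Δ) ∋ length Δ₀ + x ∶ a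
++var [] p = p
++var (m ∷ Δ₀) p = there (++var Δ₀ p)

plusT-⊢t : ∀ Δ₀ {Δ t n} → Δ S.⊢t t ∶ n → (Δ₀ ++ Δ) S.⊢t S.plusT (length Δ₀) t ∶ n
plusT-⊢t Δ₀ (S.var p) = S.var (++var Δ₀ p)
plusT-⊢t Δ₀ (S.up d) = S.up (plusT-⊢t Δ₀ d)

⊢t-cast : ∀ {Δ t n n'} → n ≡ n' → Δ S.⊢t t ∶ n → Δ S.⊢t t ∶ n'
⊢t-cast refl d = d

subT-⊢t : ∀ Δ₀ {Δ t n s m} → Δ S.⊢t t ∶ n
        → (Δ₀ ++ n ∷ Δ) S.⊢t s ∶ m → (Δ₀ ++ Δ) S.⊢t S.subT (length Δ₀) t s ∶ m
subT-⊢t Δ₀ dt (S.var {i = i} p) with varView Δ₀ p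
... | vhit e1 e2 rewrite e1 = ⊢t-cast (sym e2) (plusT-⊢t Δ₀ dt)
... | vmiss i' e p' rewrite e = S.var p'
subT-⊢t Δ₀ dt (S.up ds) = S.up (subT-⊢t Δ₀ dt ds)

wfS-sub : ∀ Δ₀ {Δ t n φ} → Δ S.⊢t t ∶ n
        → S.WF (Δ₀ ++ n ∷ Δ) φ → S.WF (Δ₀ ++ Δ) (S.sub (length Δ₀) t φ)
wfS-sub Δ₀ dt (S.ap a b) = S.ap (subT-⊢t Δ₀ dt a) (subT-⊢t Δ₀ dt b)
wfS-sub Δ₀ dt (S.eq a b) = S.eq (subT-⊢t Δ₀ dt a) (subT-⊢t Δ₀ dt b)
wfS-sub Δ₀ dt S.⊥' = S.⊥'
wfS-sub Δ₀ dt (w S.⇒ w₁) = wfS-sub Δ₀ dt w S.⇒ wfS-sub Δ₀ dt w₁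
wfS-sub Δ₀ dt (w S.∧ w₁) = wfS-sub Δ₀ dt w S.∧ wfS-sub Δ₀ dt w₁
wfS-sub Δ₀ dt (w S.∨ w₁) = wfS-sub Δ₀ dt w S.∨ wfS-sub Δ₀ dt w₁
wfS-sub Δ₀ dt (S.∀' {n = m} w) = S.∀' (wfS-sub (m ∷ Δ₀) dt w)
wfS-sub Δ₀ dt (S.∃' {n = m} w) = S.∃' (wfS-sub (m ∷ Δ₀) dt w)

chain-ups : ∀ k x → chain (ups k (S.var x)) ≡ (k , x)
chain-ups zero x = refl
chain-ups (suc k) x = cong (λ p → suc (proj₁ p) , proj₂ p) (chain-ups k x)

chain-plus : ∀ c t → chain (S.plusT c t) ≡ (proj₁ (chain t) , c + proj₂ (chain t))
chain-plus c (S.var i) = refl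
chain-plus c (S.up t) = cong (λ p → suc (proj₁ p) , proj₂ p) (chain-plus c t)

chainSub : ℕ → ℕ × ℕ → ℕ × ℕ → ℕ × ℕ
chainSub c q p = maybe (λ i' → (proj₁ p , i')) (proj₁ p + proj₁ q , c + proj₂ q) (hitv c (proj₂ p))

chain-subT : ∀ c t s → chain (S.subT c t s) ≡ chainSub c (chain t) (chain s)
chain-subT c t (S.var i) with hitv c i
... | nothing = chain-plus c t
... | just j = refl
chain-subT c t (S.up s) with hitv c (proj₂ (chain s)) | chain-subT c t s
... | nothing | e = cong (λ p → suc (proj₁ p) , proj₂ p) e
... | just j  | e = cong (λ p → suc (proj₁ p) , proj₂ p) e

-- An argument ↑^j i of an atom is untouched by the substitution unless i is the
-- substituted variable, where it becomes ↑^(j+k) x or ↑^j u: four cases.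
module AtomSubstitution (Δ₀ : Ctx) {Δ : Ctx} {Γ : List C.Fm} {a x k n u : ℕ}
  (R : ℕ → ℕ → C.Fm) (Rr : RelRen R)
  (e : a + k ≡ n) (px : Δ ∋ x ∶ a) (pu : Δ ∋ u ∶ n)
  (dH : (Δ₀ ++ Δ) ∣ Γ ⊢ IsUps a (length Δ₀ + x) k (length Δ₀ + u)) where

  c = length Δ₀
  Δc = Δ₀ ++ Δ
  pX = ++var Δ₀ px
  pU = ++var Δ₀ pu
  tyX = ∋→ty pX
  tyU = ∋→ty pU

  atomOn-sub-⇔ : ∀ j1 i1 j2 i2 {a1 a2} → (Δ₀ ++ n ∷ Δ) ∋ i1 ∶ a1 → (Δ₀ ++ n ∷ Δ) ∋ i2 ∶ a2
       → RelWF R (a1 + j1) (a2 + j2)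
       → Δc ∣ Γ ⊢ atomOn Δc R (chainSub c (k , x) (j1 , i1)) (chainSub c (k , x) (j2 , i2))
                  C.⇔ atomOn Δc R (chainSub c (0 , u) (j1 , i1)) (chainSub c (0 , u) (j2 , i2))
  atomOn-sub-⇔ j1 i1 j2 i2 p1 p2 RW with varView Δ₀ p1 | varView Δ₀ p2
  ... | vmiss i1' h₁ q1 | vmiss i2' h₂ q2 rewrite h₁ | h₂ | ∋→ty q1 | ∋→ty q2 =
    ⇔-refl (wf-elimAtom R j1 j2 q1 q2 RW)
  ... | vhit h₁ refl | vmiss i2' h₂ q2 rewrite h₁ | h₂ | ∋→ty q2 | tyX | tyU | +-identityʳ j1 =
    atom-left-⇔ R Rr j1 j2 e pX pU q2 RW dH
  ... | vmiss i1' h₁ q1 | vhit h₂ refl rewrite h₁ | h₂ | ∋→ty q1 | tyX | tyU | +-identityʳ j2 =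
    atom-right-⇔ R Rr j1 j2 e pX pU q1 RW dH
  ... | vhit h₁ refl | vhit h₂ refl rewrite h₁ | h₂ | tyX | tyU | +-identityʳ j1 | +-identityʳ j2 =
    atom-both-⇔ R Rr j1 j2 e pX pU RW dH

ups-⊢t : ∀ {Δ x a} k → Δ ∋ x ∶ a → Δ S.⊢t ups k (S.var x) ∶ (a + k)
ups-⊢t {a = a} zero p = ⊢t-cast (sym (+-identityʳ a)) (S.var p)
ups-⊢t {a = a} (suc k) p = ⊢t-cast (sym (+-suc a k)) (S.up (ups-⊢t k p))

atom-sub-ups-⇔ : ∀ Δ₀ {Δ Γ a x k n u} (R : ℕ → ℕ → C.Fm) → RelRen R → ∀ {T1 T2} t1 s1
  → (Δ₀ ++ n ∷ Δ) S.⊢t t1 ∶ T1 → (Δ₀ ++ n ∷ Δ) S.⊢t s1 ∶ T2 → RelWF R T1 T2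
  → a + k ≡ n → Δ ∋ x ∶ a → Δ ∋ u ∶ n
  → (Δ₀ ++ Δ) ∣ Γ ⊢ IsUps a (length Δ₀ + x) k (length Δ₀ + u)
  → (Δ₀ ++ Δ) ∣ Γ ⊢ atomJ (Δ₀ ++ Δ) R (S.subT (length Δ₀) (ups k (S.var x)) t1)
                                      (S.subT (length Δ₀) (ups k (S.var x)) s1)
                    C.⇔ atomJ (Δ₀ ++ Δ) R (S.subT (length Δ₀) (S.var u) t1) (S.subT (length Δ₀) (S.var u) s1)
atom-sub-ups-⇔ Δ₀ {Δ} {Γ} {a} {x} {k} {n} {u} R Rr t1 s1 dt ds RW e px pu dH
  rewrite chain-subT (length Δ₀) (ups k (S.var x)) t1 | chain-subT (length Δ₀) (ups k (S.var x)) s1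
        | chain-subT (length Δ₀) (S.var u) t1 | chain-subT (length Δ₀) (S.var u) s1 | chain-ups k x
  with chainTyping dt | chainTyping ds
... | mkChainTyping a1 p1 e1 | mkChainTyping a2 p2 e2 =
  AtomSubstitution.atomOn-sub-⇔ Δ₀ R Rr e px pu dH
    (proj₁ (chain t1)) (proj₂ (chain t1)) (proj₁ (chain s1)) (proj₂ (chain s1))
    p1 p2 (λ p q → RW (∋-cast e1 p) (∋-cast e2 q))

J-wf-ups : ∀ Δ₀ {Δ a x k n φ} → a + k ≡ n → Δ ∋ x ∶ a → S.WF (Δ₀ ++ n ∷ Δ) φ
         → C.WF (Δ₀ ++ Δ) (J (Δ₀ ++ Δ) (S.sub (length Δ₀) (ups k (S.var x)) φ))
J-wf-ups Δ₀ {k = k} e px w = J-wf (wfS-sub Δ₀ (⊢t-cast e (ups-⊢t k px)) w)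

J-wf-var : ∀ Δ₀ {Δ u n φ} → Δ ∋ u ∶ n → S.WF (Δ₀ ++ n ∷ Δ) φ
         → C.WF (Δ₀ ++ Δ) (J (Δ₀ ++ Δ) (S.sub (length Δ₀) (S.var u) φ))
J-wf-var Δ₀ pu w = J-wf (wfS-sub Δ₀ (S.var pu) w)

-- J does not commute with substituting ↑^k x; this equivalence, given that u is
-- the value of ↑^k x, replaces that commutation.
J-sub-ups-⇔ : ∀ φ Δ₀ {Δ Γ a x k n u} → a + k ≡ n → Δ ∋ x ∶ a → Δ ∋ u ∶ n → S.WF (Δ₀ ++ n ∷ Δ) φ
  → (Δ₀ ++ Δ) ∣ Γ ⊢ IsUps a (length Δ₀ + x) k (length Δ₀ + u)
  → (Δ₀ ++ Δ) ∣ Γ ⊢ J (Δ₀ ++ Δ) (S.sub (length Δ₀) (ups k (S.var x)) φ)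
                    C.⇔ J (Δ₀ ++ Δ) (S.sub (length Δ₀) (S.var u) φ)
J-sub-ups-⇔ (S.ap t s) Δ₀ e px pu (S.ap dt ds) dH =
  atom-sub-ups-⇔ Δ₀ C.ap (λ _ _ _ → refl) t s dt ds (λ p q → C.ap p q ≤-refl) e px pu dH
J-sub-ups-⇔ (S.eq t s) Δ₀ e px pu (S.eq dt ds) dH =
  atom-sub-ups-⇔ Δ₀ C.eq (λ _ _ _ → refl) t s dt ds C.eq e px pu dH
J-sub-ups-⇔ S.⊥' Δ₀ e px pu w dH = ⇔-refl C.⊥'
J-sub-ups-⇔ (φ S.⇒ ψ) Δ₀ e px pu (w₁ S.⇒ w₂) dH =
  ⇔-cong-⇒ (J-wf-ups Δ₀ e px w₁) (J-wf-var Δ₀ pu w₁) (J-wf-ups Δ₀ e px w₂) (J-wf-var Δ₀ pu w₂)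
    (J-sub-ups-⇔ φ Δ₀ e px pu w₁ dH) (J-sub-ups-⇔ ψ Δ₀ e px pu w₂ dH)
J-sub-ups-⇔ (φ S.∧ ψ) Δ₀ e px pu (w₁ S.∧ w₂) dH =
  ⇔-cong-∧ (J-wf-ups Δ₀ e px w₁) (J-wf-var Δ₀ pu w₁) (J-wf-ups Δ₀ e px w₂) (J-wf-var Δ₀ pu w₂)
    (J-sub-ups-⇔ φ Δ₀ e px pu w₁ dH) (J-sub-ups-⇔ ψ Δ₀ e px pu w₂ dH)
J-sub-ups-⇔ (φ S.∨ ψ) Δ₀ e px pu (w₁ S.∨ w₂) dH =
  ⇔-cong-∨ (J-wf-ups Δ₀ e px w₁) (J-wf-var Δ₀ pu w₁) (J-wf-ups Δ₀ e px w₂) (J-wf-var Δ₀ pu w₂)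
    (J-sub-ups-⇔ φ Δ₀ e px pu w₁ dH) (J-sub-ups-⇔ ψ Δ₀ e px pu w₂ dH)
J-sub-ups-⇔ (S.∀' m φ) Δ₀ {a = a} {x} {k} {u = u} e px pu (S.∀' w) dH =
  ⇔-cong-∀ (J-wf-ups (m ∷ Δ₀) e px w) (J-wf-var (m ∷ Δ₀) pu w)
    (J-sub-ups-⇔ φ (m ∷ Δ₀) e px pu w (⊢-≡ (IsUps-wk 0 a (length Δ₀ + x) k (length Δ₀ + u)) (wk-⊢ m dH)))
J-sub-ups-⇔ (S.∃' m φ) Δ₀ {a = a} {x} {k} {u = u} e px pu (S.∃' w) dH =
  ⇔-cong-∃ (J-wf-ups (m ∷ Δ₀) e px w) (J-wf-var (m ∷ Δ₀) pu w)
    (J-sub-ups-⇔ φ (m ∷ Δ₀) e px pu w (⊢-≡ (IsUps-wk 0 a (length Δ₀ + x) k (length Δ₀ + u)) (wk-⊢ m dH)))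

-- The axioms of STT^↑ under J

J-IdScheme : ∀ {Δ Γ} n → Δ ∣ Γ ⊢ J Δ (S.IdScheme n)
J-IdScheme {Δ} n = ∀I-same (C.∀' w-body) (∀I-same w-body
  (⇔I wEq wL (eq⇒Leibniz (there here) here ≤-refl hyp₀) (Leibniz⇒eq (there here) here ≤-refl hyp₀)))
  where
    wEq : C.WF (n ∷ n ∷ Δ) (C.eq 1 0)
    wEq = C.eq (there here) here
    wL : C.WF (n ∷ n ∷ Δ) (Leibniz (suc n) 1 0)
    wL = wf-Leibniz (there here) here ≤-refl ≤-refl
    w-body : C.WF (n ∷ n ∷ Δ) (C.eq 1 0 C.⇔ Leibniz (suc n) 1 0)
    w-body = wf-⇔ wEq wL

J-UpBase : ∀ {Δ Γ} → Δ ∣ Γ ⊢ J Δ S.UpBase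
J-UpBase {Δ} = ∀I-same (C.∀' w-body) (∀I-same w-body (C.⇒I w-desc
  (∃E-same (wf-IsUp (there here) here C.∧ C.ap here (there (there here)) ≤-refl) hyp₀
    (type-base (there (there here)) (there here)
      (Elem-intro (there (there here)) (there here) here ≤-refl
        (Equiv-sym (there here) here (IsUp⇒Equiv (there here) here (C.∧E₁ hyp₀)))
        (C.∧E₂ hyp₀))))))
  where
    w-desc : C.WF (0 ∷ 0 ∷ Δ) (desc 0 0 (C.ap 0 2))
    w-desc = wf-desc here (C.ap here (there (there here)) ≤-refl)
    w-body : C.WF (0 ∷ 0 ∷ Δ) (desc 0 0 (C.ap 0 2) C.⇒ C.⊥')
    w-body = w-desc C.⇒ C.⊥'

J-UpInject : ∀ {Δ Γ} n → Δ ∣ Γ ⊢ J Δ (S.UpInject n)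
J-UpInject {Δ} n = ∀I-same (C.∀' w-body) (∀I-same w-body (C.⇒I w-desc
  (∃E-same (wf-IsUp (there (there here)) here C.∧ w-inner) hyp₀
    (∃E-same (wf-IsUp (there (there here)) here C.∧ C.eq (there here) here) (C.∧E₂ hyp₀)
      (Equiv-lower-unique x y (there here)
        (IsUp⇒Equiv x (there here) (C.∧E₁ hyp₁))
        (C.subst= {φ = C.Equiv n (suc n) 3 0} (wf-Equiv (there y) here) here
          (=-sym (there here) (C.∧E₂ hyp₀))
          (IsUp⇒Equiv y here (C.∧E₁ hyp₀))))))))
  where
    x : (suc n ∷ suc n ∷ n ∷ n ∷ Δ) ∋ 3 ∶ n
    x = there (there (there here))
    y : (suc n ∷ suc n ∷ n ∷ n ∷ Δ) ∋ 2 ∶ n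
    y = there (there here)
    w-inner : C.WF (suc n ∷ n ∷ n ∷ Δ) (desc n 1 (C.eq 1 0))
    w-inner = wf-desc (there here) (C.eq (there here) here)
    w-desc : C.WF (n ∷ n ∷ Δ) (desc n 1 (desc n 1 (C.eq 1 0)))
    w-desc = wf-desc (there here) w-inner
    w-body : C.WF (n ∷ n ∷ Δ) (desc n 1 (desc n 1 (C.eq 1 0)) C.⇒ C.eq 1 0)
    w-body = w-desc C.⇒ C.eq (there here) here

-- If ↑y(x) then x ∈̂ y (witnessed by ↑y), so Type-Founded yields z with x ≡ z, i.e. x = ↑z.
J-UpFounded : ∀ {Δ Γ} n → Δ ∣ Γ ⊢ J Δ (S.UpFounded n)
J-UpFounded {Δ} n = ∀I-same (C.∀' w-body) (∀I-same w-body (C.⇒I w-desc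
  (∃E-same (wf-IsUp (there here) here C.∧ C.ap here (there (there here)) ≤-refl) hyp₀
    (∃E-same (wf-Equiv (there (there (there here))) here)
      (type-founded (there (there here)) (there here) x∈̂y)
      (C.∃I ≤-refl here w-goal
        (desc-intro here (there (there (there here))) (C.eq (there (there (there (there here)))) here)
          (Equiv⇒IsUp here (there (there (there here))) (Equiv-sym (there (there (there here))) here hyp₀))
          (C.refl= (there (there (there here))))))))))
  where
    w-desc : C.WF (suc n ∷ suc n ∷ Δ) (desc (suc n) 0 (C.ap 0 2))
    w-desc = wf-desc here (C.ap here (there (there here)) ≤-refl)
    w-body : C.WF (suc n ∷ suc n ∷ Δ) (desc (suc n) 0 (C.ap 0 2) C.⇒ C.∃' n (desc n 0 (C.eq 3 0)))
    w-body = w-desc C.⇒ C.∃' (wf-desc here (C.eq (there (there (there here))) here))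
    w-goal : C.WF (n ∷ suc (suc n) ∷ suc n ∷ suc n ∷ Δ) (C.∃' n (desc n 0 (C.eq 5 0)))
    w-goal = C.∃' (wf-desc here (C.eq (there (there (there (there (there here))))) here))
    x∈̂y : ∀ {Γ′} → (suc (suc n) ∷ suc n ∷ suc n ∷ Δ) ∣ (IsUp (suc n) 1 0 C.∧ C.ap 0 2) ∷ Γ′
                     ⊢ C.Elem (suc n) (suc n) 2 1
    x∈̂y = Elem-intro (there (there here)) (there here) here (s≤s (m≤m⊔n (suc n) (suc n)))
      (⊢-≡ (cong (λ k → C.Equiv (suc k) (suc n) 0 1) (sym (⊔-idem (suc n))))
        (Equiv-sym (there here) here (IsUp⇒Equiv (there here) here (C.∧E₁ hyp₀))))
      (C.∧E₂ hyp₀)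

-- With U = ↑y and V = ↑x: U(V) ↔ U(x) as x ≡ V, and U(x) ↔ y(x) as y ≡ U.
J-UpPossess : ∀ {Δ Γ} n → Δ ∣ Γ ⊢ J Δ (S.UpPossess n)
J-UpPossess {Δ} n = ∀I-same (C.∀' w-body) (∀I-same w-body
  (∃E-same (wf-IsUp (there here) here) (IsUp-exists here)
    (∃E-same (wf-IsUp (there (there (there here))) here) (IsUp-exists (there (there here)))
      (⇔-trans (wf-desc y w-inner) w-yx (desc-⇔ y U w-inner hyp₁)
        (⇔-trans (wf-desc x w-UV′) w-yx (desc-⇔ x V w-UV′ hyp₀)
          (⇔-trans w-UV w-yx
            (⇔-sym (Leibniz-at U (ssn≤ n) (n<ssn n) ≤-refl x V (IsUp⇒Equiv x V hyp₀)))
            (⇔-sym (Equiv-members y U x ≤-refl (n<ssn n) (IsUp⇒Equiv y U hyp₁)))))))))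
  where
    Δ₄ = suc n ∷ suc (suc n) ∷ suc n ∷ n ∷ Δ
    V : Δ₄ ∋ 0 ∶ suc n
    V = here
    U : Δ₄ ∋ 1 ∶ suc (suc n)
    U = there here
    y : Δ₄ ∋ 2 ∶ suc n
    y = there (there here)
    x : Δ₄ ∋ 3 ∶ n
    x = there (there (there here))
    w-UV : C.WF Δ₄ (C.ap 1 0)
    w-UV = C.ap U V ≤-refl
    w-UV′ : C.WF (suc n ∷ Δ₄) (C.ap 2 0)
    w-UV′ = C.ap (there U) here ≤-refl
    w-yx : C.WF Δ₄ (C.ap 2 3)
    w-yx = C.ap y x ≤-refl
    w-inner : C.WF (suc (suc n) ∷ Δ₄) (desc n 4 (C.ap 1 0))
    w-inner = wf-desc (there x) (C.ap (there here) here ≤-refl)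
    w-body : C.WF (suc n ∷ n ∷ Δ) (desc (suc n) 0 (desc n 2 (C.ap 1 0)) C.⇔ C.ap 0 1)
    w-body = wf-⇔ (wf-desc here (wf-desc (there (there here)) (C.ap (there here) here ≤-refl)))
                  (C.ap here (there here) ≤-refl)

-- Translating the rules of STT^↑

-- ValueOf I says that the fresh variable 0 is the value of the term t.
ValueOf : ∀ {Δ t n} → ChainTyping Δ t n → C.Fm
ValueOf {t = t} (mkChainTyping a px e) = IsUps a (suc (proj₂ (chain t))) (proj₁ (chain t)) 0

wf-ValueOf : ∀ {Δ t n} (I : ChainTyping Δ t n) → C.WF (n ∷ Δ) (ValueOf I)
wf-ValueOf {t = t} (mkChainTyping a px e) = wf-IsUps (proj₁ (chain t)) (there px) (∋-cast (sym e) here)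

ValueOf-exists : ∀ {Δ Γ t n} (I : ChainTyping Δ t n) → Δ ∣ Γ ⊢ C.∃' n (ValueOf I)
ValueOf-exists {Δ} {Γ} {t} (mkChainTyping a px e) =
  subst (λ T → Δ ∣ Γ ⊢ C.∃' T _) e (IsUps-exists (proj₁ (chain t)) px)

J-sub-⇔ : ∀ {Δ Γ t n φ} (I : ChainTyping Δ t n) → S.WF (n ∷ Δ) φ
        → (n ∷ Δ) ∣ Γ ⊢ ValueOf I → (n ∷ Δ) ∣ Γ ⊢ C.wk 0 (J Δ (φ S.[ t ])) C.⇔ J (n ∷ Δ) φ
J-sub-⇔ {Δ} {t = t} {n} {φ} (mkChainTyping a px e) w dH =
  ⊢-≡ (cong₂ C._⇔_ eqL eqR) (J-sub-ups-⇔ (S.wk 1 φ) [] e (there px) here (wfS-wk1 w) dH)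
  where
    k = proj₁ (chain t)
    x = proj₂ (chain t)
    ups-wk : ups k (S.var (suc x)) ≡ S.wkT 0 t
    ups-wk = trans (sym (wkT-ups 0 k x)) (cong (S.wkT 0) (sym (chain-eta t)))
    eqL : J (n ∷ Δ) (S.sub 0 (ups k (S.var (suc x))) (S.wk 1 φ)) ≡ C.wk 0 (J Δ (S.sub 0 t φ))
    eqL = trans (cong (λ z → J (n ∷ Δ) (S.sub 0 z (S.wk 1 φ))) ups-wk)
          (trans (cong (J (n ∷ Δ)) (sub-wk-suc 0 t φ)) (J-wk0 Δ n (S.sub 0 t φ)))
    eqR : J (n ∷ Δ) (S.sub 0 (S.var 0) (S.wk 1 φ)) ≡ J (n ∷ Δ) φ
    eqR = cong (J (n ∷ Δ)) (sub-var0-wk1 φ)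

J-∀E : ∀ {Δ Γ φ t n} → Δ S.⊢t t ∶ n → S.WF (n ∷ Δ) φ
     → Δ ∣ Γ ⊢ C.∀' n (J (n ∷ Δ) φ) → Δ ∣ Γ ⊢ J Δ (φ S.[ t ])
J-∀E {n = n} pt w d =
  C.∃E ≤-refl (wf-ValueOf I) (ValueOf-exists I)
    (⇔← (J-sub-⇔ I w hyp₀) (∀E-here (J-wf w) (wkΓ (wk-⊢ n d))))
  where I = chainTyping pt

J-∃I : ∀ {Δ Γ φ t n} → Δ S.⊢t t ∶ n → S.WF (n ∷ Δ) φ
     → Δ ∣ Γ ⊢ J Δ (φ S.[ t ]) → Δ ∣ Γ ⊢ C.∃' n (J (n ∷ Δ) φ)
J-∃I {n = n} pt w d =
  C.∃E ≤-refl (wf-ValueOf I) (ValueOf-exists I)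
    (∃I-here (J-wf w) (⇔→ (J-sub-⇔ I w hyp₀) (wkΓ (wk-⊢ n d))))
  where I = chainTyping pt

J-refl= : ∀ {Δ Γ t n} → Δ S.⊢t t ∶ n → Δ ∣ Γ ⊢ J Δ (S.eq t t)
J-refl= {Δ} {t = t} pt =
  C.∃E ≤-refl (wf-ValueOf I) (ValueOf-exists I)
    (⊢-≡ (cong (λ z → C.wk 0 (J Δ z)) (cong₂ S.eq (plusT0 t) (plusT0 t)))
      (⇔← (J-sub-⇔ I (S.eq (S.var here) (S.var here)) hyp₀) (C.refl= here)))
  where I = chainTyping pt

-- With u and v the values of s and t, J(s = t) becomes u = v and
-- J(φ[s]) becomes J φ at u, so the CTT^ω substitution rule applies.
J-subst= : ∀ {Δ Γ φ s t n} → S.WF (n ∷ Δ) φ → Δ S.⊢t s ∶ n → Δ S.⊢t t ∶ n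
         → Δ ∣ Γ ⊢ J Δ (S.eq s t) → Δ ∣ Γ ⊢ J Δ (φ S.[ s ]) → Δ ∣ Γ ⊢ J Δ (φ S.[ t ])
J-subst= {Δ} {Γ} {φ} {s} {t} {n} wφ ps pt d e =
  C.∃E ≤-refl (wf-ValueOf Is) (ValueOf-exists Is)
    (C.∃E ≤-refl (wf-ValueOf It) (ValueOf-exists It)
      (⊢-≡ (cong (C.wk 0) (trans (cong (J (n ∷ Δ)) (sub-wk-suc 0 t φ)) (J-wk0 Δ n (S.sub 0 t φ))))
        (⇔← (J-sub-⇔ It (wfS-wk1 wφ) hyp₀) (⊢-≡ (sym (J-wk1 Δ n n φ)) φ-at-v))))
  where
    pt↑ : (n ∷ Δ) S.⊢t S.wkT 0 t ∶ n
    pt↑ = subst (λ z → (n ∷ Δ) S.⊢t z ∶ n) (sym (wkT-ren 0 t)) (renT-ty there pt)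
    Is = chainTyping ps
    It = chainTyping pt↑
    X = J (n ∷ Δ) φ
    Γs = ValueOf Is ∷ map (C.wk 0) Γ
    Γst = ValueOf It ∷ map (C.wk 0) Γs
    u=t : (n ∷ Δ) ∣ Γs ⊢ J (n ∷ Δ) (S.eq (S.var 0) (S.wkT 0 t))
    u=t = ⇔→ (J-sub-⇔ Is (S.eq (S.var here) pt↑) hyp₀)
            (⊢-≡ (cong (λ z → C.wk 0 (J Δ z)) (cong₂ S.eq (sym (plusT0 s)) (sym (subT-wkT s t))))
                 (wkΓ (wk-⊢ n d)))
    φ-at-u : (n ∷ Δ) ∣ Γs ⊢ X
    φ-at-u = ⇔→ (J-sub-⇔ Is wφ hyp₀) (wkΓ (wk-⊢ n e))
    u=v : (n ∷ n ∷ Δ) ∣ Γst ⊢ C.eq 1 0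
    u=v = ⇔→ (J-sub-⇔ It (S.eq (S.var (there here)) (S.var here)) hyp₀)
            (⊢-≡ (cong (λ z → C.wk 0 (J (n ∷ Δ) (S.eq (S.var 0) z))) (sym (plusT0 (S.wkT 0 t))))
                 (wkΓ (wk-⊢ n u=t)))
    φ-at-v : (n ∷ n ∷ Δ) ∣ Γst ⊢ C.wk 1 X
    φ-at-v = ⊢-≡ (wk1-[0] (C.wk 1 X))
      (C.subst= {φ = C.wk 1 (C.wk 1 X)} (wf-wk1 (wf-wk1 (J-wf wφ))) (there here) u=v
        (⊢-≡ (sym (trans (wk1-[suc] (C.wk 1 X) 0) (cong (C.wk 0) (wk1-[0] X))))
             (wkΓ (wk-⊢ n φ-at-u))))

J-comp : ∀ {Δ Γ φ n} → S.WF (n ∷ Δ) φ → Δ ∣ Γ ⊢ J Δ (S.Comprehension n φ)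
J-comp {Δ} {φ = φ} {n} w =
  ⊢-≡ (cong (λ z → C.∃' (suc n) (C.∀' n (C.ap 1 0 C.⇔ z))) (sym (J-wk1 Δ n (suc n) φ)))
      (C.comp (J-wf w))

AllWF : Ctx → List S.Fm → Set
AllWF Δ Γ = ∀ {ψ} → ψ ∈ Γ → S.WF Δ ψ

allwf-∷ : ∀ {Δ Γ φ} → S.WF Δ φ → AllWF Δ Γ → AllWF Δ (φ ∷ Γ)
allwf-∷ w a (here refl) = w
allwf-∷ w a (there p) = a p

allwf-wk : ∀ {Δ Γ n} → AllWF Δ Γ → AllWF (n ∷ Δ) (map (S.wk 0) Γ)
allwf-wk a p with ∈-map⁻ (S.wk 0) p
... | ψ , q , refl = wfS-wk0 (a q)

⊢-wf : ∀ {Δ Γ φ} → Δ S.∣ Γ ⊢ φ → AllWF Δ Γ → S.WF Δ φ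
⊢-wf (S.hyp p) a = a p
⊢-wf (S.⊥E w d) a = w
⊢-wf (S.raa w d) a = w
⊢-wf (S.⇒I w d) a = w S.⇒ ⊢-wf d (allwf-∷ w a)
⊢-wf (S.⇒E d e) a with ⊢-wf d a
... | _ S.⇒ w = w
⊢-wf (S.∧I d e) a = ⊢-wf d a S.∧ ⊢-wf e a
⊢-wf (S.∧E₁ d) a with ⊢-wf d a
... | w S.∧ _ = w
⊢-wf (S.∧E₂ d) a with ⊢-wf d a
... | _ S.∧ w = w
⊢-wf (S.∨I₁ w d) a = ⊢-wf d a S.∨ w
⊢-wf (S.∨I₂ w d) a = w S.∨ ⊢-wf d a
⊢-wf (S.∨E d e₁ e₂) a with ⊢-wf d a
... | w S.∨ _ = ⊢-wf e₁ (allwf-∷ w a)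
⊢-wf (S.∀I d) a = S.∀' (⊢-wf d (allwf-wk a))
⊢-wf (S.∀E pt d) a with ⊢-wf d a
... | S.∀' w = wfS-sub [] pt w
⊢-wf (S.∃I pt w d) a = w
⊢-wf (S.∃E {ψ = ψ} d e) a with ⊢-wf d a
... | S.∃' w = wfS-str0 ψ (⊢-wf e (allwf-∷ w (allwf-wk a)))
⊢-wf (S.refl= pt) a = S.eq pt pt
⊢-wf (S.subst= w ps d e) a with ⊢-wf d a
... | S.eq ps′ pt = wfS-sub [] (⊢t-cast (⊢t-uniq ps′ ps) pt) w
⊢-wf (S.comp w) a = S.∃' (S.∀' (wf-⇔ₛ (S.ap (S.var (there here)) (S.var here)) (wfS-wk1 w)))
⊢-wf (S.idScheme n) a = wf-IdScheme
⊢-wf (S.upInject n) a = wf-UpInject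
⊢-wf (S.upPossess n) a = wf-UpPossess
⊢-wf (S.upFounded n) a = wf-UpFounded
⊢-wf S.upBase a = wf-UpBase

J-map-wk : ∀ Δ n Γ → map (J (n ∷ Δ)) (map (S.wk 0) Γ) ≡ map (C.wk 0) (map (J Δ) Γ)
J-map-wk Δ n Γ = trans (sym (map-∘ Γ)) (trans (map-cong (J-wk0 Δ n) Γ) (map-∘ Γ))

J-⊢ : ∀ {Δ Γ φ} → Δ S.∣ Γ ⊢ φ → AllWF Δ Γ → Δ ∣ map (J Δ) Γ ⊢ J Δ φ
J-⊢ (S.hyp p) a = C.hyp (∈-map⁺ _ p)
J-⊢ (S.⊥E w d) a = C.⊥E (J-wf w) (J-⊢ d a)
J-⊢ (S.raa w d) a = C.raa (J-wf w) (J-⊢ d (allwf-∷ (w S.⇒ S.⊥') a))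
J-⊢ (S.⇒I w d) a = C.⇒I (J-wf w) (J-⊢ d (allwf-∷ w a))
J-⊢ (S.⇒E d e) a = C.⇒E (J-⊢ d a) (J-⊢ e a)
J-⊢ (S.∧I d e) a = C.∧I (J-⊢ d a) (J-⊢ e a)
J-⊢ (S.∧E₁ d) a = C.∧E₁ (J-⊢ d a)
J-⊢ (S.∧E₂ d) a = C.∧E₂ (J-⊢ d a)
J-⊢ (S.∨I₁ w d) a = C.∨I₁ (J-wf w) (J-⊢ d a)
J-⊢ (S.∨I₂ w d) a = C.∨I₂ (J-wf w) (J-⊢ d a)
J-⊢ (S.∨E d e₁ e₂) a with ⊢-wf d a
... | w₁ S.∨ w₂ = C.∨E (J-⊢ d a) (J-⊢ e₁ (allwf-∷ w₁ a)) (J-⊢ e₂ (allwf-∷ w₂ a))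
J-⊢ {Δ} {Γ} (S.∀I {n = n} d) a =
  C.∀I ≤-refl (J-wf (⊢-wf d (allwf-wk a))) (ctx-≡ (J-map-wk Δ n Γ) (J-⊢ d (allwf-wk a)))
J-⊢ (S.∀E pt d) a with ⊢-wf d a
... | S.∀' w = J-∀E pt w (J-⊢ d a)
J-⊢ (S.∃I pt (S.∃' w) d) a = J-∃I pt w (J-⊢ d a)
J-⊢ {Δ} {Γ} (S.∃E {ψ = ψ} {n = n} d e) a with ⊢-wf d a
... | S.∃' w = C.∃E ≤-refl (J-wf w) (J-⊢ d a)
  (⊢-≡ (J-wk0 Δ n ψ) (ctx-≡ (cong (_ ∷_) (J-map-wk Δ n Γ)) (J-⊢ e (allwf-∷ w (allwf-wk a)))))
J-⊢ (S.refl= pt) a = J-refl= pt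
J-⊢ (S.subst= w ps d e) a with ⊢-wf d a
... | S.eq ps′ pt = J-subst= w ps (⊢t-cast (⊢t-uniq ps′ ps) pt) (J-⊢ d a) (J-⊢ e a)
J-⊢ (S.comp w) a = J-comp w
J-⊢ (S.idScheme n) a = J-IdScheme n
J-⊢ (S.upInject n) a = J-UpInject n
J-⊢ (S.upPossess n) a = J-UpPossess n
J-⊢ (S.upFounded n) a = J-UpFounded n
J-⊢ S.upBase a = J-UpBase

lemmaC4 : (Δ : Ctx) (φ : STT.Fm) → Δ STT.∣ [] ⊢ φ → Δ CTT.∣ [] ⊢ J Δ φ
lemmaC4 Δ φ d = J-⊢ d (λ ())
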